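{- Let $p\equiv 1\pmod 4$ be a prime. Then $$\prod_{\substack{1\le i<j\le (p-1)/2\\ i^2+j^2\not\equiv 0\pmod p}}(j^2-i^2)\equiv -\left(\frac{2}{p}\right)\pmod p,$$ where $\left(\frac{2}{p}\right)$ is the Legendre symbol. -}

module Defs where

open import Data.Nat as ℕ using (ℕ; zero; suc; _%_; _/_)
open import Data.Nat.Properties as ℕP using ()
open import Data.Integer as ℤ using (ℤ; +_; -_; _-_; _*_; 0ℤ; 1ℤ)
open import Data.Integer.Divisibility as ℤD using ()
open import Data.Nat.Divisibility as ℕD using ()
open import Data.List using (List; []; _∷_; filter; upTo; map; concatMap; foldr)
open import Data.List.Relation.Unary.Any using (Any; any?)
open import Data.Product using (_×_; _,_)
open import Relation.Nullary using (Dec; yes; no; ¬_; ¬?)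
open import Relation.Binary.PropositionalEquality using (_≡_)

_≡_[mod_] : ℤ → ℤ → ℕ → Set
a ≡ b [mod m ] = (+ m) ℤD.∣ (a - b)

oneTo : ℕ → List ℕ
oneTo n = map suc (upTo n)

pairsLt : ℕ → List (ℕ × ℕ)
pairsLt n = concatMap (λ j → map (λ i → (i , j)) (oneTo (ℕ.pred j))) (oneTo n)

IsSquareMod : ℕ → ℕ → Set
IsSquareMod p a = Any (λ x → (+ (x ℕ.* x)) ≡ (+ a) [mod p ]) (upTo p)

isSquareMod? : ∀ p a → Dec (IsSquareMod p a)
isSquareMod? p a = any? (λ x → p ℕD.∣? ℤ.∣ (+ (x ℕ.* x)) - (+ a) ∣) (upTo p)

legendre : ℕ → ℕ → ℤ
legendre p a with p ℕD.∣? a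
... | yes _ = 0ℤ
... | no _ with isSquareMod? p a
...   | yes _ = 1ℤ
...   | no _  = - 1ℤ

ℤproduct : List ℤ → ℤ
ℤproduct = foldr _*_ 1ℤ

cor27Product : ℕ → ℤ
cor27Product p =
  ℤproduct (map (λ { (i , j) → (+ (j ℕ.* j)) - (+ (i ℕ.* i)) })
               (filter (λ { (i , j) → ¬? (p ℕD.∣? ((i ℕ.* i) ℕ.+ (j ℕ.* j))) })
                       (pairsLt ((p ℕ.∸ 1) / 2))))

-- Let p = 4m + 1 and n = 2m. Sorting the factors j² - i² (1 ≤ i < j ≤ n) of A = ∏ (j² - i²)
-- according to whether p divides i² + j² writes A = G · B, where G is the product of the corollary.
-- As ∏_{i<j} (j² - i²) · j = (2j - 1)!, pairing j with n + 1 - j and using Wilson's theorem on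
-- (2j - 1)! (2n + 1 - 2j)! gives A · n! ≡ 1.
-- Let k² ≡ -1. Every x ∈ [1, n] has exactly one partner σ x ∈ [1, n] with p ∣ x² + (σ x)², namely ±k x,
-- and σ is a fixed-point-free involution, so B is a product over the m pairs x > σ x of
-- x² - (σ x)² ≡ -2 (σ x)². The map {x, σ x} ↦ {±(x + σ x), x - σ x} permutes these pairs, the smaller
-- element of the image being x - σ x; hence ∏ σ x = ∏ (x - σ x), and (x - σ x)² ≡ -2 x σ x gives
-- B ≡ (-2)^m · (-2)^m n! = 2^n n!. Finally 2^n ≡ (2/p) by Euler's criterion and n!² ≡ -1 by Wilson's
-- theorem, so G ≡ (A n!) / (B n!) ≡ -(2/p).

module Submission where

open import Defs
open import Algebra.Bundles using (CommutativeSemigroup)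
open import Algebra.Core using (Op₂)
import Algebra.Properties.CommutativeSemigroup as CommutativeSemigroupProperties
open import Algebra.Structures using (IsCommutativeMonoid)
open import Data.Empty using (⊥; ⊥-elim)
open import Data.Integer as ℤ using (ℤ; +_; -_; _-_; _+_; _*_; _^_; 0ℤ; 1ℤ; ∣_∣)
open import Data.Integer.DivMod using (n%ℕd<d; a≡a%ℕn+[a/ℕn]*n)
open import Data.Integer.Divisibility.Signed using (_∣_; divides; ∣⇒∣ᵤ; ∣ᵤ⇒∣; ∣m∣n⇒∣m+n; ∣m⇒∣-m; ∣m⇒∣m*n; ∣n⇒∣m*n)
import Data.Integer.Properties as ℤP
open import Data.Integer.Tactic.RingSolver using (solve-∀)
open import Data.List using (List; []; _∷_; _++_; [_]; map; upTo; length; filter; concatMap)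
open import Data.List.Membership.Propositional using (_∈_; find; lose)
open import Data.List.Membership.Propositional.Properties using (∈-map⁺; ∈-map⁻; ∈-upTo⁺; ∈-upTo⁻)
import Data.List.Properties as ListP
open import Data.List.Relation.Unary.All as All using (All; []; _∷_)
open import Data.List.Relation.Unary.Any using (here; there; any?)
open import Data.List.Relation.Unary.Unique.Propositional using (Unique; []; _∷_)
import Data.List.Relation.Unary.Unique.Propositional.Properties as UniqueP
open import Data.Nat as ℕ using (ℕ; zero; suc; _≤_; _<_; _∸_; _/_; _%_; _≤?_; _<?_; _≟_)
open import Data.Nat.Coprimality as Coprime using (coprime-Bézout; prime⇒coprime)
open import Data.Nat.DivMod using (m<n⇒m%n≡m; m*n/n≡m; m≡m%n+[m/n]*n)
open import Data.Nat.Divisibility as ℕD using (n∣m⇒m%n≡0)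
open import Data.Nat.GCD using (module Bézout)
open import Data.Nat.Primality using (Prime; euclidsLemma; prime⇒nonTrivial)
import Data.Nat.Properties as ℕP
import Data.Nat.Tactic.RingSolver as ℕSolver
open import Data.Product as Product using (Σ; _×_; _,_; proj₁; proj₂)
open import Data.Sum as Sum using (_⊎_; inj₁; inj₂; [_,_]′)
open import Function using (_∘_)
open import Level using (0ℓ)
open import Relation.Binary.Bundles using (Setoid)
open import Relation.Binary.PropositionalEquality hiding ([_])
import Relation.Binary.Reasoning.Setoid as SetoidReasoning
open import Relation.Nullary using (Dec; yes; no; ¬_; ¬?)
import Relation.Nullary.Decidable as Dec

pos-∸ : ∀ {m n} → n ≤ m → + (m ∸ n) ≡ + m - + n
pos-∸ {m} {n} n≤m = sym (trans (ℤP.m-n≡m⊖n m n) (ℤP.⊖-≥ n≤m))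

1+*≡*⇒ℤ : ∀ {u v w z} → 1 ℕ.+ u ℕ.* v ≡ w ℕ.* z → 1ℤ + + u * + v ≡ + w * + z
1+*≡*⇒ℤ {u} {v} {w} {z} eq = begin
  1ℤ + + u * + v     ≡⟨ cong (λ t → 1ℤ + t) (ℤP.pos-* u v) ⟨
  + (1 ℕ.+ u ℕ.* v)  ≡⟨ cong +_ eq ⟩
  + (w ℕ.* z)        ≡⟨ ℤP.pos-* w z ⟩
  + w * + z          ∎
  where open ≡-Reasoning

m∸n+[m+n]≡m+m : ∀ {m n} → n ≤ m → (m ∸ n) ℕ.+ (m ℕ.+ n) ≡ m ℕ.+ m
m∸n+[m+n]≡m+m {m} {n} n≤m = begin
  (m ∸ n) ℕ.+ (m ℕ.+ n)  ≡⟨ cong ((m ∸ n) ℕ.+_) (ℕP.+-comm m n) ⟩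
  (m ∸ n) ℕ.+ (n ℕ.+ m)  ≡⟨ ℕP.+-assoc (m ∸ n) n m ⟨
  (m ∸ n ℕ.+ n) ℕ.+ m    ≡⟨ cong (ℕ._+ m) (ℕP.m∸n+n≡m n≤m) ⟩
  m ℕ.+ m                ∎
  where open ≡-Reasoning

even-or-odd : ∀ z → Σ ℕ λ q → z ≡ q ℕ.+ q ⊎ z ≡ suc (q ℕ.+ q)
even-or-odd zero    = 0 , inj₁ refl
even-or-odd (suc z) with even-or-odd z
... | q , inj₁ z≡2q   = q , inj₂ (cong suc z≡2q)
... | q , inj₂ z≡2q+1 = suc q , inj₁ (cong suc (trans z≡2q+1 (sym (ℕP.+-suc q q))))

double-<⇒< : ∀ {a b} → a ℕ.+ a < b ℕ.+ b → a < b
double-<⇒< {a} {b} 2a<2b = ℕP.≰⇒> λ b≤a → ℕP.<⇒≱ 2a<2b (ℕP.+-mono-≤ b≤a b≤a)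

double-≤⇒≤ : ∀ {a b} → a ℕ.+ a ≤ b ℕ.+ b → a ≤ b
double-≤⇒≤ {a} {b} 2a≤2b = ℕP.≮⇒≥ λ b<a → ℕP.<⇒≱ (ℕP.+-mono-< b<a b<a) 2a≤2b

odd≢even : ∀ a b → suc (b ℕ.+ b) ≢ a ℕ.+ a
odd≢even zero    b       ()
odd≢even (suc a) zero    eq = ℕP.0≢1+n (trans (ℕP.suc-injective eq) (ℕP.+-suc a a))
odd≢even (suc a) (suc b) eq = odd≢even a b (ℕP.suc-injective (begin
  suc (suc (b ℕ.+ b))  ≡⟨ cong suc (ℕP.+-suc b b) ⟨
  suc (b ℕ.+ suc b)    ≡⟨ ℕP.suc-injective eq ⟩
  a ℕ.+ suc a          ≡⟨ ℕP.+-suc a a ⟩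
  suc (a ℕ.+ a)        ∎))
  where open ≡-Reasoning

double-injective : ∀ {a b} → a ℕ.+ a ≡ b ℕ.+ b → a ≡ b
double-injective {a} {b} eq = ℕP.*-cancelˡ-≡ a b 2 (trans (lemma a) (trans eq (sym (lemma b))))
  where lemma : ∀ x → 2 ℕ.* x ≡ x ℕ.+ x
        lemma x = cong (x ℕ.+_) (ℕP.+-identityʳ x)

-1^-even : ∀ k → (- 1ℤ) ^ (k ℕ.+ k) ≡ 1ℤ
-1^-even zero    = refl
-1^-even (suc k) rewrite ℕP.+-suc k k = trans (sym (ℤP.*-assoc (- 1ℤ) (- 1ℤ) _)) (trans (ℤP.*-identityˡ _) (-1^-even k))

-1^-odd : ∀ k → (- 1ℤ) ^ suc (k ℕ.+ k) ≡ - 1ℤ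
-1^-odd k = cong (- 1ℤ *_) (-1^-even k)

remove : ℕ → List ℕ → List ℕ
remove u [] = []
remove u (x ∷ xs) with x ≟ u
... | yes _ = xs
... | no _  = x ∷ remove u xs

module _ {u : ℕ} where

  ∈-remove⁻ : ∀ {y} xs → y ∈ remove u xs → y ∈ xs
  ∈-remove⁻ (x ∷ xs) m with x ≟ u
  ... | yes _ = there m
  ∈-remove⁻ (x ∷ xs) (here eq) | no _ = here eq
  ∈-remove⁻ (x ∷ xs) (there m) | no _ = there (∈-remove⁻ xs m)

  ∈-remove⁺ : ∀ {y} xs → y ∈ xs → y ≢ u → y ∈ remove u xs
  ∈-remove⁺ (x ∷ xs) m y≢u with x ≟ u
  ∈-remove⁺ (x ∷ xs) (here refl) y≢u | yes x≡u = ⊥-elim (y≢u x≡u)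
  ∈-remove⁺ (x ∷ xs) (there m)   y≢u | yes _   = m
  ∈-remove⁺ (x ∷ xs) (here eq)   y≢u | no _    = here eq
  ∈-remove⁺ (x ∷ xs) (there m)   y≢u | no _    = there (∈-remove⁺ xs m y≢u)

  All-remove : ∀ {P : ℕ → Set} xs → All P xs → All P (remove u xs)
  All-remove [] [] = []
  All-remove (x ∷ xs) (px ∷ pxs) with x ≟ u
  ... | yes _ = pxs
  ... | no _  = px ∷ All-remove xs pxs

  Unique-remove : ∀ xs → Unique xs → Unique (remove u xs)
  Unique-remove [] [] = []
  Unique-remove (x ∷ xs) (x∉xs ∷ uxs) with x ≟ u
  ... | yes _ = uxs
  ... | no _  = All-remove xs x∉xs ∷ Unique-remove xs uxs

  ∈-remove⇒≢ : ∀ {y} xs → Unique xs → y ∈ remove u xs → y ≢ u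
  ∈-remove⇒≢ (x ∷ xs) (x∉xs ∷ uxs) m with x ≟ u
  ∈-remove⇒≢ (x ∷ xs) (x∉xs ∷ uxs) m         | yes refl = All.lookup x∉xs m ∘ sym
  ∈-remove⇒≢ (x ∷ xs) (x∉xs ∷ uxs) (here refl) | no x≢u = x≢u
  ∈-remove⇒≢ (x ∷ xs) (x∉xs ∷ uxs) (there m)   | no _   = ∈-remove⇒≢ xs uxs m

record IsBijectionOn (t : ℕ → ℕ) (L M : List ℕ) : Set where
  field
    maps-to    : ∀ {x} → x ∈ L → t x ∈ M
    injective  : ∀ {x y} → x ∈ L → y ∈ L → t x ≡ t y → x ≡ y
    surjective : ∀ {y} → y ∈ M → Σ ℕ λ x → x ∈ L × t x ≡ y

involution⇒bijection : ∀ {τ L} → (∀ {x} → x ∈ L → τ x ∈ L) → (∀ {x} → x ∈ L → τ (τ x) ≡ x) →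
                       IsBijectionOn τ L L
involution⇒bijection {τ} closed involutive = record
  { maps-to    = closed
  ; injective  = λ x∈L y∈L τx≡τy → trans (sym (involutive x∈L)) (trans (cong τ τx≡τy) (involutive y∈L))
  ; surjective = λ {y} y∈L → τ y , closed y∈L , involutive y∈L
  }

∈-oneTo⁺ : ∀ {x K} → 0 < x → x ≤ K → x ∈ oneTo K
∈-oneTo⁺ {suc x} _ x<K = ∈-map⁺ suc (∈-upTo⁺ x<K)

∈-oneTo⁻ : ∀ {x K} → x ∈ oneTo K → 0 < x × x ≤ K
∈-oneTo⁻ x∈ with ∈-map⁻ suc x∈
... | _ , y∈ , refl = ℕ.s≤s ℕ.z≤n , ∈-upTo⁻ y∈

oneTo-unique : ∀ K → Unique (oneTo K)
oneTo-unique K = UniqueP.map⁺ ℕP.suc-injective (UniqueP.upTo⁺ K)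

length-oneTo : ∀ K → length (oneTo K) ≡ K
length-oneTo K = trans (ListP.length-map suc (upTo K)) (ListP.length-upTo K)

oneTo-suc : ∀ K → oneTo (suc K) ≡ oneTo K ++ [ suc K ]
oneTo-suc K = trans (cong (map suc) (sym (ListP.upTo-∷ʳ K))) (ListP.map-++ suc (upTo K) [ K ])

reflect-∈ : ∀ {K x} → x ∈ oneTo K → suc K ∸ x ∈ oneTo K
reflect-∈ {K} x∈ with ∈-oneTo⁻ x∈
... | 0<x , x≤K = ∈-oneTo⁺ (ℕP.m<n⇒0<n∸m (ℕ.s≤s x≤K)) (ℕP.∸-monoʳ-≤ (suc K) 0<x)

reflect-involutive : ∀ {K x} → x ∈ oneTo K → suc K ∸ (suc K ∸ x) ≡ x
reflect-involutive x∈ = ℕP.m∸[m∸n]≡n (ℕP.m≤n⇒m≤1+n (proj₂ (∈-oneTo⁻ x∈)))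

reflection-bijection : ∀ K → IsBijectionOn (λ x → suc K ∸ x) (oneTo K) (oneTo K)
reflection-bijection K = involution⇒bijection reflect-∈ reflect-involutive

first : ∀ {Q : ℕ → Set} → (∀ x → Dec (Q x)) → List ℕ → ℕ
first Q? []       = 0
first Q? (x ∷ xs) with Q? x
... | yes _ = x
... | no _  = first Q? xs

first-satisfies : ∀ {Q : ℕ → Set} (Q? : ∀ x → Dec (Q x)) xs {y} → y ∈ xs → Q y →
                  first Q? xs ∈ xs × Q (first Q? xs)
first-satisfies Q? (x ∷ xs) y∈ Qy with Q? x
... | yes Qx = here refl , Qx
first-satisfies Q? (x ∷ xs) (here refl) Qy | no ¬Qx = ⊥-elim (¬Qx Qy)
first-satisfies Q? (x ∷ xs) (there y∈)  Qy | no _   = Product.map₁ there (first-satisfies Q? xs y∈ Qy)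

-- Finite products in a commutative monoid

module BigOperator {A : Set} {_∙_ : Op₂ A} {ε : A} (isCM : IsCommutativeMonoid _≡_ _∙_ ε) where

  open IsCommutativeMonoid isCM using (assoc; identityˡ; identityʳ; isCommutativeSemigroup)
  ∙-commutativeSemigroup : CommutativeSemigroup 0ℓ 0ℓ
  ∙-commutativeSemigroup = record { isCommutativeSemigroup = isCommutativeSemigroup }

  open CommutativeSemigroupProperties ∙-commutativeSemigroup using () renaming (x∙yz≈y∙xz to ∙-exchange)

  big : (ℕ → A) → List ℕ → A
  big f []       = ε
  big f (x ∷ xs) = f x ∙ big f xs

  select : {P : Set} → Dec P → A → A
  select (yes _) a = a
  select (no _)  _ = ε

  select-yes : ∀ {P : Set} (d : Dec P) a → P → select d a ≡ a
  select-yes (yes _) a _  = refl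
  select-yes (no ¬p) a p  = ⊥-elim (¬p p)

  select-no : ∀ {P : Set} (d : Dec P) a → ¬ P → select d a ≡ ε
  select-no (yes p) a ¬p = ⊥-elim (¬p p)
  select-no (no _)  a _  = refl

  select-ε : ∀ {P : Set} (d : Dec P) → select d ε ≡ ε
  select-ε (yes _) = refl
  select-ε (no _)  = refl

  select-¬?-∙ : ∀ {P : Set} (d : Dec P) a → select (¬? d) a ∙ select d a ≡ a
  select-¬?-∙ (yes _) a = identityˡ a
  select-¬?-∙ (no _)  a = identityʳ a

  select-∙ : ∀ {P : Set} (d : Dec P) a b → select d a ∙ select d b ≡ select d (a ∙ b)
  select-∙ (yes _) a b = refl
  select-∙ (no _)  a b = identityˡ ε

  big-cong : ∀ {f g} xs → (∀ {x} → x ∈ xs → f x ≡ g x) → big f xs ≡ big g xs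
  big-cong []       f≗g = refl
  big-cong (x ∷ xs) f≗g = cong₂ _∙_ (f≗g (here refl)) (big-cong xs (λ m → f≗g (there m)))

  big-ε : ∀ f xs → (∀ {x} → x ∈ xs → f x ≡ ε) → big f xs ≡ ε
  big-ε f []       f≗ε = refl
  big-ε f (x ∷ xs) f≗ε = trans (cong₂ _∙_ (f≗ε (here refl)) (big-ε f xs (λ m → f≗ε (there m)))) (identityˡ ε)

  big-∙ : ∀ f g xs → big (λ x → f x ∙ g x) xs ≡ big f xs ∙ big g xs
  big-∙ f g []       = sym (identityˡ ε)
  big-∙ f g (x ∷ xs) = begin
    (f x ∙ g x) ∙ big (λ x → f x ∙ g x) xs  ≡⟨ cong ((f x ∙ g x) ∙_) (big-∙ f g xs) ⟩
    (f x ∙ g x) ∙ (big f xs ∙ big g xs)     ≡⟨ assoc _ _ _ ⟩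
    f x ∙ (g x ∙ (big f xs ∙ big g xs))     ≡⟨ cong (f x ∙_) (∙-exchange _ _ _) ⟩
    f x ∙ (big f xs ∙ (g x ∙ big g xs))     ≡⟨ assoc _ _ _ ⟨
    (f x ∙ big f xs) ∙ (g x ∙ big g xs)     ∎
    where open ≡-Reasoning

  big-++ : ∀ f xs ys → big f (xs ++ ys) ≡ big f xs ∙ big f ys
  big-++ f []       ys = sym (identityˡ _)
  big-++ f (x ∷ xs) ys = trans (cong (f x ∙_) (big-++ f xs ys)) (sym (assoc (f x) _ _))

  big-remove : ∀ f {u} xs → u ∈ xs → big f xs ≡ f u ∙ big f (remove u xs)
  big-remove f {u} (x ∷ xs) m with x ≟ u
  ... | yes refl = refl
  big-remove f {u} (x ∷ xs) (here refl) | no x≢u = ⊥-elim (x≢u refl)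
  big-remove f {u} (x ∷ xs) (there m)   | no _   =
    trans (cong (f x ∙_) (big-remove f xs m)) (∙-exchange (f x) (f u) _)

  big-reindex : ∀ F {t L M} → Unique L → Unique M → IsBijectionOn t L M →
                big (λ x → F (t x)) L ≡ big F M
  big-reindex F {L = []} {[]} _ _ _ = refl
  big-reindex F {L = []} {y ∷ M} _ _ bij with IsBijectionOn.surjective bij (here refl)
  ... | _ , () , _
  big-reindex F {t} {x ∷ L} {M} (x∉L ∷ uL) uM bij =
    trans (cong (F (t x) ∙_) (big-reindex F uL (Unique-remove M uM) bij′))
          (sym (big-remove F M (maps-to (here refl))))
    where
    open IsBijectionOn bij
    bij′ : IsBijectionOn t L (remove (t x) M)
    bij′ = record
      { maps-to    = λ y∈L → ∈-remove⁺ M (maps-to (there y∈L))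
                       (λ ty≡tx → All.lookup x∉L y∈L (sym (injective (there y∈L) (here refl) ty≡tx)))
      ; injective  = λ y∈L z∈L → injective (there y∈L) (there z∈L)
      ; surjective = λ z∈M′ → preimage (surjective (∈-remove⁻ M z∈M′)) (∈-remove⇒≢ M uM z∈M′)
      }
      where
      preimage : ∀ {z} → Σ ℕ (λ y → y ∈ x ∷ L × t y ≡ z) → z ≢ t x → Σ ℕ λ y → y ∈ L × t y ≡ z
      preimage (_ , here refl , ty≡z) z≢tx = ⊥-elim (z≢tx (sym ty≡z))
      preimage (y , there y∈L , ty≡z) _    = y , y∈L , ty≡z

  big-one-point : ∀ f {u xs} → Unique xs → u ∈ xs → (∀ {x} → x ∈ xs → x ≢ u → f x ≡ ε) →
                  big f xs ≡ f u
  big-one-point f {u} {xs} uxs u∈xs others = begin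
    big f xs                   ≡⟨ big-remove f xs u∈xs ⟩
    f u ∙ big f (remove u xs)  ≡⟨ cong (f u ∙_) (big-ε f (remove u xs) λ x∈ → others (∈-remove⁻ xs x∈) (∈-remove⇒≢ xs uxs x∈)) ⟩
    f u ∙ ε                    ≡⟨ identityʳ (f u) ⟩
    f u                        ∎
    where open ≡-Reasoning

  big-two-point : ∀ f {u v xs} → Unique xs → u ∈ xs → v ∈ xs → u ≢ v →
                  (∀ {x} → x ∈ xs → x ≢ u → x ≢ v → f x ≡ ε) → big f xs ≡ f u ∙ f v
  big-two-point f {u} {v} {xs} uxs u∈xs v∈xs u≢v others = begin
    big f xs                   ≡⟨ big-remove f xs u∈xs ⟩
    f u ∙ big f (remove u xs)  ≡⟨ cong (f u ∙_) (big-one-point f (Unique-remove xs uxs) (∈-remove⁺ xs v∈xs (u≢v ∘ sym))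
                                    λ x∈ → others (∈-remove⁻ xs x∈) (∈-remove⇒≢ xs uxs x∈)) ⟩
    f u ∙ f v                  ∎
    where open ≡-Reasoning

  module _ {τ : ℕ → ℕ} {L : List ℕ} (uL : Unique L)
           (closed : ∀ {x} → x ∈ L → τ x ∈ L) (involutive : ∀ {x} → x ∈ L → τ (τ x) ≡ x) where

    big-involution : ∀ g → big g L ≡ big (λ x → select (τ x <? x) (g x ∙ g (τ x))) L
                                   ∙ big (λ x → select (τ x ≟ x) (g x)) L
    big-involution g = begin
      big g L                                                  ≡⟨ big-cong L (λ {x} _ → trichotomy x) ⟩
      big (λ x → (below x ∙ above x) ∙ fixed x) L              ≡⟨ big-∙ _ fixed L ⟩
      big (λ x → below x ∙ above x) L ∙ Fixed                  ≡⟨ cong (_∙ Fixed) (big-∙ below above L) ⟩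
      (big below L ∙ big above L) ∙ Fixed                      ≡⟨ cong (λ z → (big below L ∙ z) ∙ Fixed) above-reindex ⟨
      (big below L ∙ big partner L) ∙ Fixed                    ≡⟨ cong (_∙ Fixed) (big-∙ below partner L) ⟨
      big (λ x → below x ∙ partner x) L ∙ Fixed                ≡⟨ cong (_∙ Fixed) (big-cong L λ {x} _ → select-∙ (τ x <? x) (g x) (g (τ x))) ⟩
      big (λ x → select (τ x <? x) (g x ∙ g (τ x))) L ∙ Fixed  ∎
      where
      open ≡-Reasoning
      below above partner fixed : ℕ → A
      below   x = select (τ x <? x) (g x)
      above   x = select (x <? τ x) (g x)
      partner x = select (τ x <? x) (g (τ x))
      fixed   x = select (τ x ≟ x) (g x)
      Fixed : A
      Fixed = big fixed L

      trichotomy : ∀ x → g x ≡ (below x ∙ above x) ∙ fixed x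
      trichotomy x with τ x <? x | x <? τ x | τ x ≟ x
      ... | yes τx<x | yes x<τx | _        = ⊥-elim (ℕP.<-asym τx<x x<τx)
      ... | yes τx<x | no _     | yes τx≡x = ⊥-elim (ℕP.<-irrefl τx≡x τx<x)
      ... | yes _    | no _     | no _     = sym (trans (identityʳ _) (identityʳ (g x)))
      ... | no _     | yes x<τx | yes τx≡x = ⊥-elim (ℕP.<-irrefl (sym τx≡x) x<τx)
      ... | no _     | yes _    | no _     = sym (trans (identityʳ _) (identityˡ (g x)))
      ... | no _     | no _     | yes _    = sym (trans (cong (_∙ g x) (identityˡ ε)) (identityˡ (g x)))
      ... | no τx≮x  | no x≮τx  | no τx≢x  = ⊥-elim (τx≢x (ℕP.≤-antisym (ℕP.≮⇒≥ x≮τx) (ℕP.≮⇒≥ τx≮x)))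

      above-reindex : big partner L ≡ big above L
      above-reindex = trans (big-cong L λ x∈L → cong (λ y → select (τ _ <? y) (g (τ _))) (sym (involutive x∈L)))
                            (big-reindex above uL uL (involution⇒bijection closed involutive))

open BigOperator ℤP.*-1-isCommutativeMonoid

module Sumℕ = BigOperator ℕP.+-0-isCommutativeMonoid

count : ∀ {Q : ℕ → Set} → (∀ x → Dec (Q x)) → List ℕ → ℕ
count Q? = Sumℕ.big (λ x → Sumℕ.select (Q? x) 1)

big-select-const : ∀ {Q : ℕ → Set} (Q? : ∀ x → Dec (Q x)) c xs →
                   big (λ x → select (Q? x) c) xs ≡ c ^ count Q? xs
big-select-const Q? c []       = refl
big-select-const Q? c (x ∷ xs) with Q? x
... | yes _ = cong (c *_) (big-select-const Q? c xs)
... | no _  = trans (ℤP.*-identityˡ _) (big-select-const Q? c xs)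

module _ {τ : ℕ → ℕ} {L : List ℕ} (uL : Unique L)
         (closed : ∀ {x} → x ∈ L → τ x ∈ L) (involutive : ∀ {x} → x ∈ L → τ (τ x) ≡ x) where

  length-involution : length L ≡ (count (λ x → τ x <? x) L ℕ.+ count (λ x → τ x <? x) L)
                                 ℕ.+ count (λ x → τ x ≟ x) L
  length-involution = begin
    length L              ≡⟨ ones L ⟨
    Sumℕ.big (λ _ → 1) L  ≡⟨ Sumℕ.big-involution uL closed involutive (λ _ → 1) ⟩
    Sumℕ.big (λ x → Sumℕ.select (τ x <? x) 2) L ℕ.+ fixed
                                                     ≡⟨ cong (ℕ._+ fixed) (twos L) ⟩
    (below L ℕ.+ below L) ℕ.+ fixed                  ∎
    where
    open ≡-Reasoning
    below : List ℕ → ℕ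
    below = count (λ x → τ x <? x)
    fixed : ℕ
    fixed = count (λ x → τ x ≟ x) L
    ones : ∀ xs → Sumℕ.big (λ _ → 1) xs ≡ length xs
    ones []       = refl
    ones (x ∷ xs) = cong suc (ones xs)
    twos : ∀ xs → Sumℕ.big (λ x → Sumℕ.select (τ x <? x) 2) xs ≡ below xs ℕ.+ below xs
    twos []       = refl
    twos (x ∷ xs) with τ x <? x
    ... | yes _ = cong suc (trans (cong suc (twos xs)) (sym (ℕP.+-suc _ _)))
    ... | no _  = twos xs

module Congruence (p : ℕ) where

  infix 4 _≈_
  record _≈_ (a b : ℤ) : Set where
    constructor mk≈
    field divides-difference : + p ∣ a - b
  open _≈_ public

  private
    mk≈-by : ∀ {a b d} → d ≡ a - b → + p ∣ d → a ≈ b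
    mk≈-by refl = mk≈

  ≈-refl : ∀ {a} → a ≈ a
  ≈-refl {a} = mk≈ (divides 0ℤ (ℤP.+-inverseʳ a))

  ≈-sym : ∀ {a b} → a ≈ b → b ≈ a
  ≈-sym {a} {b} (mk≈ p∣a-b) = mk≈-by (lemma a b) (∣m⇒∣-m p∣a-b)
    where lemma : ∀ a b → - (a - b) ≡ b - a
          lemma = solve-∀

  ≈-trans : ∀ {a b c} → a ≈ b → b ≈ c → a ≈ c
  ≈-trans {a} {b} {c} (mk≈ p∣a-b) (mk≈ p∣b-c) = mk≈-by (lemma a b c) (∣m∣n⇒∣m+n p∣a-b p∣b-c)
    where lemma : ∀ a b c → (a - b) + (b - c) ≡ a - c
          lemma = solve-∀

  ≡⇒≈ : ∀ {a b} → a ≡ b → a ≈ b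
  ≡⇒≈ refl = ≈-refl

  ≈-setoid : Setoid 0ℓ 0ℓ
  ≈-setoid = record
    { Carrier = ℤ ; _≈_ = _≈_
    ; isEquivalence = record { refl = ≈-refl ; sym = ≈-sym ; trans = ≈-trans } }

  module ≈-Reasoning = SetoidReasoning ≈-setoid

  +-cong : ∀ {a b c d} → a ≈ b → c ≈ d → a + c ≈ b + d
  +-cong {a} {b} {c} {d} (mk≈ p∣a-b) (mk≈ p∣c-d) = mk≈-by (lemma a b c d) (∣m∣n⇒∣m+n p∣a-b p∣c-d)
    where lemma : ∀ a b c d → (a - b) + (c - d) ≡ (a + c) - (b + d)
          lemma = solve-∀

  *-cong : ∀ {a b c d} → a ≈ b → c ≈ d → a * c ≈ b * d
  *-cong {a} {b} {c} {d} (mk≈ p∣a-b) (mk≈ p∣c-d) =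
    mk≈-by (lemma a b c d) (∣m∣n⇒∣m+n (∣m⇒∣m*n c p∣a-b) (∣n⇒∣m*n b p∣c-d))
    where lemma : ∀ a b c d → (a - b) * c + b * (c - d) ≡ a * c - b * d
          lemma = solve-∀

  -‿cong : ∀ {a b} → a ≈ b → - a ≈ - b
  -‿cong {a} {b} (mk≈ p∣a-b) = mk≈-by (lemma a b) (∣m⇒∣-m p∣a-b)
    where lemma : ∀ a b → - (a - b) ≡ - a - - b
          lemma = solve-∀

  ^-cong : ∀ {a b} n → a ≈ b → a ^ n ≈ b ^ n
  ^-cong zero    a≈b = ≈-refl
  ^-cong (suc n) a≈b = *-cong a≈b (^-cong n a≈b)

  *-congˡ : ∀ c {a b} → a ≈ b → c * a ≈ c * b
  *-congˡ c = *-cong (≈-refl {c})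

  *-congʳ : ∀ c {a b} → a ≈ b → a * c ≈ b * c
  *-congʳ c a≈b = *-cong a≈b (≈-refl {c})

  big-≈ : ∀ {f g} xs → (∀ {x} → x ∈ xs → f x ≈ g x) → big f xs ≈ big g xs
  big-≈ []       f≈g = ≈-refl
  big-≈ (x ∷ xs) f≈g = *-cong (f≈g (here refl)) (big-≈ xs (λ x∈ → f≈g (there x∈)))

  select-≈ : ∀ {P : Set} (d : Dec P) {a b} → a ≈ b → select d a ≈ select d b
  select-≈ (yes _) a≈b = a≈b
  select-≈ (no _)  _   = ≈-refl

  p≈0 : + p ≈ 0ℤ
  p≈0 = mk≈ (divides 1ℤ (trans (ℤP.+-identityʳ (+ p)) (sym (ℤP.*-identityˡ (+ p)))))

  ∣⇒≈0 : ∀ {a} → + p ∣ a → a ≈ 0ℤ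
  ∣⇒≈0 {a} = mk≈-by (sym (ℤP.+-identityʳ a))

  ≈0⇒∣ : ∀ {a} → a ≈ 0ℤ → + p ∣ a
  ≈0⇒∣ {a} (mk≈ p∣a-0) = subst (+ p ∣_) (ℤP.+-identityʳ a) p∣a-0

  ≈⇒≡[mod] : ∀ {a b} → a ≈ b → a ≡ b [mod p ]
  ≈⇒≡[mod] (mk≈ p∣a-b) = ∣⇒∣ᵤ p∣a-b

  ≡[mod]⇒≈ : ∀ {a b} → a ≡ b [mod p ] → a ≈ b
  ≡[mod]⇒≈ = mk≈ ∘ ∣ᵤ⇒∣

  ≈⇒-≈0 : ∀ {a b} → a ≈ b → a - b ≈ 0ℤ
  ≈⇒-≈0 = ∣⇒≈0 ∘ divides-difference

  -≈0⇒≈ : ∀ {a b} → a - b ≈ 0ℤ → a ≈ b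
  -≈0⇒≈ = mk≈ ∘ ≈0⇒∣

  +≈0⇒≈- : ∀ {a b} → a + b ≈ 0ℤ → b ≈ - a
  +≈0⇒≈- {a} {b} a+b≈0 = mk≈-by (lemma a b) (divides-difference a+b≈0)
    where lemma : ∀ a b → a + b - 0ℤ ≡ b - - a
          lemma = solve-∀

  ≈-⇒+≈0 : ∀ {a b} → b ≈ - a → a + b ≈ 0ℤ
  ≈-⇒+≈0 {a} {b} b≈-a = mk≈-by (lemma a b) (divides-difference b≈-a)
    where lemma : ∀ a b → b - - a ≡ a + b - 0ℤ
          lemma = solve-∀

  ∤⇒≉0 : ∀ {a} → ¬ p ℕD.∣ a → ¬ + a ≈ 0ℤ
  ∤⇒≉0 p∤a = p∤a ∘ ∣⇒∣ᵤ ∘ ≈0⇒∣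

  module _ (p-prime : Prime p) where

    *≈0⇒≈0⊎≈0 : ∀ {a b} → a * b ≈ 0ℤ → a ≈ 0ℤ ⊎ b ≈ 0ℤ
    *≈0⇒≈0⊎≈0 {a} {b} ab≈0 with euclidsLemma ∣ a ∣ ∣ b ∣ p-prime
                                  (subst (p ℕD.∣_) (ℤP.abs-* a b) (∣⇒∣ᵤ (≈0⇒∣ ab≈0)))
    ... | inj₁ p∣a = inj₁ (∣⇒≈0 (∣ᵤ⇒∣ p∣a))
    ... | inj₂ p∣b = inj₂ (∣⇒≈0 (∣ᵤ⇒∣ p∣b))

    *-≉0 : ∀ {a b} → ¬ a ≈ 0ℤ → ¬ b ≈ 0ℤ → ¬ a * b ≈ 0ℤ
    *-≉0 a≉0 b≉0 ab≈0 = [ a≉0 , b≉0 ]′ (*≈0⇒≈0⊎≈0 ab≈0)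

    *-cancelˡ-≈ : ∀ {c a b} → ¬ c ≈ 0ℤ → c * a ≈ c * b → a ≈ b
    *-cancelˡ-≈ {c} {a} {b} c≉0 ca≈cb =
      [ ⊥-elim ∘ c≉0 , -≈0⇒≈ ]′ (*≈0⇒≈0⊎≈0 (≈-trans (≡⇒≈ (lemma c a b)) (≈⇒-≈0 ca≈cb)))
      where lemma : ∀ c a b → c * (a - b) ≡ c * a - c * b
            lemma = solve-∀

    square≈square⇒≈± : ∀ {x y} → x * x ≈ y * y → x ≈ y ⊎ x ≈ - y
    square≈square⇒≈± {x} {y} xx≈yy =
      Sum.map -≈0⇒≈ (λ x+y≈0 → -≈0⇒≈ (≈-trans (≡⇒≈ (lemma₂ x y)) x+y≈0))
              (*≈0⇒≈0⊎≈0 (≈-trans (≡⇒≈ (lemma₁ x y)) (≈⇒-≈0 xx≈yy)))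
      where lemma₁ : ∀ x y → (x - y) * (x + y) ≡ x * x - y * y
            lemma₁ = solve-∀
            lemma₂ : ∀ x y → x - - y ≡ x + y
            lemma₂ = solve-∀

    inverse-exists : ∀ {x} → 0 < x → x < p → Σ ℤ λ c → + x * c ≈ 1ℤ
    inverse-exists {x@(suc _)} _ x<p with coprime-Bézout (Coprime.sym (prime⇒coprime p-prime x<p))
    ... | Bézout.+- X Y eq = + X , mk≈ (divides (+ Y) (begin
      + x * + X - 1ℤ         ≡⟨ cong (_- 1ℤ) (trans (ℤP.*-comm (+ x) (+ X)) (sym (1+*≡*⇒ℤ {Y} {p} {X} {x} eq))) ⟩
      (1ℤ + + Y * + p) - 1ℤ  ≡⟨ lemma (+ Y * + p) ⟩
      + Y * + p              ∎))
      where
      open ≡-Reasoning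
      lemma : ∀ z → (1ℤ + z) - 1ℤ ≡ z
      lemma = solve-∀
    ... | Bézout.-+ X Y eq = - + X , mk≈ (divides (- + Y) (begin
      + x * - + X - 1ℤ    ≡⟨ lemma₁ (+ x) (+ X) ⟩
      - (1ℤ + + X * + x)  ≡⟨ cong -_ (1+*≡*⇒ℤ {X} {x} {Y} {p} eq) ⟩
      - (+ Y * + p)       ≡⟨ lemma₂ (+ Y) (+ p) ⟩
      - + Y * + p         ∎))
      where
      open ≡-Reasoning
      lemma₁ : ∀ x X → x * - X - 1ℤ ≡ - (1ℤ + X * x)
      lemma₁ = solve-∀
      lemma₂ : ∀ Y P → - (Y * P) ≡ - Y * P
      lemma₂ = solve-∀

  module _ .{{_ : ℕ.NonZero p}} where

    residue-injective-≤ : ∀ {x y} → y ≤ x → x < p → + x ≈ + y → x ≡ y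
    residue-injective-≤ {x} {y} y≤x x<p (mk≈ p∣x-y) = ℕP.≤-antisym (ℕP.m∸n≡0⇒m≤n x∸y≡0) y≤x
      where
      p∣x∸y : p ℕD.∣ x ∸ y
      p∣x∸y = ∣⇒∣ᵤ (subst (+ p ∣_) (sym (pos-∸ y≤x)) p∣x-y)
      x∸y≡0 : x ∸ y ≡ 0
      x∸y≡0 = trans (sym (m<n⇒m%n≡m (ℕP.≤-<-trans (ℕP.m∸n≤m x y) x<p))) (n∣m⇒m%n≡0 (x ∸ y) p p∣x∸y)

    residue-injective : ∀ {x y} → x < p → y < p → + x ≈ + y → x ≡ y
    residue-injective {x} {y} x<p y<p x≈y with ℕP.≤-total y x
    ... | inj₁ y≤x = residue-injective-≤ y≤x x<p x≈y
    ... | inj₂ x≤y = sym (residue-injective-≤ x≤y y<p (≈-sym x≈y))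

    residue-≉0 : ∀ {x} → 0 < x → x < p → ¬ + x ≈ 0ℤ
    residue-≉0 0<x x<p x≈0 = ℕP.<⇒≢ 0<x (sym (residue-injective x<p (ℕP.<-trans 0<x x<p) x≈0))

    reduce : ℤ → ℕ
    reduce a = a ℤ.%ℕ p

    reduce<p : ∀ a → reduce a < p
    reduce<p a = n%ℕd<d a p

    ≈-reduce : ∀ a → a ≈ + reduce a
    ≈-reduce a = mk≈ (divides (a ℤ./ℕ p) (lemma {a} {+ reduce a} {a ℤ./ℕ p} (a≡a%ℕn+[a/ℕn]*n a p)))
      where
      lemma : ∀ {a r q} → a ≡ r + q * + p → a - r ≡ q * + p
      lemma {r = r} {q} refl = identity r q (+ p)
        where identity : ∀ r q P → (r + q * P) - r ≡ q * P
              identity = solve-∀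

  infix 4 _≈?_
  _≈?_ : ∀ a b → Dec (a ≈ b)
  a ≈? b = Dec.map′ (mk≈ ∘ ∣ᵤ⇒∣) (∣⇒∣ᵤ ∘ divides-difference) (p ℕD.∣? ∣ a - b ∣)

  ≈-∸ : ∀ {y} → y ≤ p → + (p ∸ y) ≈ - + y
  ≈-∸ {y} y≤p = begin
    + (p ∸ y)    ≡⟨ pos-∸ y≤p ⟩
    + p + - + y  ≈⟨ +-cong p≈0 (≈-refl { - + y}) ⟩
    0ℤ + - + y   ≡⟨ ℤP.+-identityˡ (- + y) ⟩
    - + y        ∎
    where open ≈-Reasoning

factorial : ℕ → ℤ
factorial r = big (λ i → + i) (oneTo r)

factorial-suc : ∀ r → factorial (suc r) ≡ factorial r * + suc r
factorial-suc r = begin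
  big (λ i → + i) (oneTo (suc r))         ≡⟨ cong (big (λ i → + i)) (oneTo-suc r) ⟩
  big (λ i → + i) (oneTo r ++ [ suc r ])  ≡⟨ big-++ (λ i → + i) (oneTo r) [ suc r ] ⟩
  factorial r * (+ suc r * 1ℤ)            ≡⟨ cong (factorial r *_) (ℤP.*-identityʳ (+ suc r)) ⟩
  factorial r * + suc r                   ∎
  where open ≡-Reasoning

module _ {N : ℕ} where

  open Congruence (suc N)

  -- The top factor q of q! is ≡ -(r + 1) modulo r + q + 1 and moves over to r!.
  factorial-reflection : ∀ q r → r ℕ.+ q ≡ N → factorial r * ((- 1ℤ) ^ q * factorial q) ≈ factorial N
  factorial-reflection zero    r r+0≡N rewrite ℕP.+-identityʳ r | r+0≡N = ≡⇒≈ (ℤP.*-identityʳ _)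
  factorial-reflection (suc q) r r+q+1≡N = begin
    factorial r * ((- 1ℤ) ^ suc q * factorial (suc q))   ≡⟨ cong (λ t → factorial r * ((- 1ℤ) ^ suc q * t)) (factorial-suc q) ⟩
    factorial r * ((- 1ℤ) ^ suc q * (factorial q * + suc q))
      ≈⟨ *-congˡ (factorial r) (*-congˡ ((- 1ℤ) ^ suc q) (*-congˡ (factorial q) q+1≈-[r+1])) ⟩
    factorial r * ((- 1ℤ) ^ suc q * (factorial q * - + suc r))
      ≡⟨ lemma (factorial r) ((- 1ℤ) ^ q) (factorial q) (+ suc r) ⟩
    (factorial r * + suc r) * ((- 1ℤ) ^ q * factorial q)  ≡⟨ cong (_* ((- 1ℤ) ^ q * factorial q)) (factorial-suc r) ⟨
    factorial (suc r) * ((- 1ℤ) ^ q * factorial q)        ≈⟨ factorial-reflection q (suc r) (trans (sym (ℕP.+-suc r q)) r+q+1≡N) ⟩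
    factorial N                                           ∎
    where
    open ≈-Reasoning
    lemma : ∀ A B C s → A * ((- 1ℤ * B) * (C * - s)) ≡ (A * s) * (B * C)
    lemma = solve-∀
    q+1≈-[r+1] : + suc q ≈ - + suc r
    q+1≈-[r+1] = begin
      + suc q                      ≡⟨ cong +_ (ℕP.m+n∸n≡m (suc q) (suc r)) ⟨
      + (suc q ℕ.+ suc r ∸ suc r)  ≡⟨ cong (λ t → + (t ∸ suc r)) sum≡p ⟩
      + (suc N ∸ suc r)            ≈⟨ ≈-∸ (subst (suc r ≤_) sum≡p (ℕP.m≤n+m (suc r) (suc q))) ⟩
      - + suc r                    ∎
      where
      sum≡p : suc q ℕ.+ suc r ≡ suc N
      sum≡p = cong suc (trans (ℕP.+-comm q (suc r)) (trans (sym (ℕP.+-suc r q)) r+q+1≡N))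

squareDifferences : ℕ → ℤ
squareDifferences j = big (λ i → + (j ℕ.* j) - + (i ℕ.* i)) (oneTo (ℕ.pred j))

big-shifted : ∀ J t → big (λ i → + J + + i) (oneTo t) * factorial J ≡ factorial (J ℕ.+ t)
big-shifted J zero    = trans (ℤP.*-identityˡ _) (cong factorial (sym (ℕP.+-identityʳ J)))
big-shifted J (suc t) = begin
  big shifted (oneTo (suc t)) * factorial J         ≡⟨ cong (λ xs → big shifted xs * factorial J) (oneTo-suc t) ⟩
  big shifted (oneTo t ++ [ suc t ]) * factorial J  ≡⟨ cong (_* factorial J) (big-++ shifted (oneTo t) [ suc t ]) ⟩
  (big shifted (oneTo t) * (shifted (suc t) * 1ℤ)) * factorial J
                                                     ≡⟨ lemma (big shifted (oneTo t)) (shifted (suc t)) (factorial J) ⟩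
  (big shifted (oneTo t) * factorial J) * shifted (suc t)
                                                     ≡⟨ cong₂ _*_ (big-shifted J t) (sym (ℤP.pos-+ J (suc t))) ⟩
  factorial (J ℕ.+ t) * + (J ℕ.+ suc t)  ≡⟨ cong (λ k → factorial (J ℕ.+ t) * + k) (ℕP.+-suc J t) ⟩
  factorial (J ℕ.+ t) * + suc (J ℕ.+ t)  ≡⟨ factorial-suc (J ℕ.+ t) ⟨
  factorial (suc (J ℕ.+ t))              ≡⟨ cong factorial (ℕP.+-suc J t) ⟨
  factorial (J ℕ.+ suc t)                ∎
  where
  open ≡-Reasoning
  shifted : ℕ → ℤ
  shifted i = + J + + i
  lemma : ∀ A B C → (A * (B * 1ℤ)) * C ≡ (A * C) * B
  lemma = solve-∀

-- As i runs through 1 … j - 1, the factors j - i and j + i of j² - i² run through 1 … j - 1 and j + 1 … 2j - 1.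
squareDifferences-suc : ∀ t → squareDifferences (suc t) * + suc t ≡ factorial (suc (t ℕ.+ t))
squareDifferences-suc t = begin
  squareDifferences j * + j
    ≡⟨ cong (_* + j) (big-cong (oneTo t) λ i∈ → difference-of-squares (ℕP.m≤n⇒m≤1+n (proj₂ (∈-oneTo⁻ i∈)))) ⟩
  big (λ i → + (j ∸ i) * (+ j + + i)) (oneTo t) * + j
    ≡⟨ cong (_* + j) (big-∙ (λ i → + (j ∸ i)) (λ i → + j + + i) (oneTo t)) ⟩
  (big (λ i → + (j ∸ i)) (oneTo t) * Shifted) * + j  ≡⟨ cong (λ z → (z * Shifted) * + j) reflected ⟩
  (factorial t * Shifted) * + j                      ≡⟨ lemma (factorial t) Shifted (+ j) ⟩
  Shifted * (factorial t * + j)                      ≡⟨ cong (Shifted *_) (factorial-suc t) ⟨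
  Shifted * factorial j                              ≡⟨ big-shifted j t ⟩
  factorial (suc (t ℕ.+ t))                          ∎
  where
  open ≡-Reasoning
  j : ℕ
  j = suc t
  Shifted : ℤ
  Shifted = big (λ i → + j + + i) (oneTo t)
  lemma : ∀ A B C → (A * B) * C ≡ B * (A * C)
  lemma = solve-∀
  difference-of-squares : ∀ {i} → i ≤ j → + (j ℕ.* j) - + (i ℕ.* i) ≡ + (j ∸ i) * (+ j + + i)
  difference-of-squares {i} i≤j = begin
    + (j ℕ.* j) - + (i ℕ.* i)  ≡⟨ cong₂ _-_ (ℤP.pos-* j j) (ℤP.pos-* i i) ⟩
    + j * + j - + i * + i      ≡⟨ factor (+ j) (+ i) ⟩
    (+ j - + i) * (+ j + + i)  ≡⟨ cong (_* (+ j + + i)) (pos-∸ i≤j) ⟨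
    + (j ∸ i) * (+ j + + i)    ∎
    where factor : ∀ j i → j * j - i * i ≡ (j - i) * (j + i)
          factor = solve-∀
  reflected : big (λ i → + (j ∸ i)) (oneTo t) ≡ factorial t
  reflected = big-reindex (λ i → + i) (oneTo-unique t) (oneTo-unique t) (reflection-bijection t)

-- Wilson's theorem and Euler's criterion

module OddPrime (n : ℕ) (p-prime : Prime (suc (n ℕ.+ n))) where

  p : ℕ
  p = suc (n ℕ.+ n)

  open Congruence p public

  units : List ℕ
  units = oneTo (n ℕ.+ n)

  units-unique : Unique units
  units-unique = oneTo-unique (n ℕ.+ n)

  ∈units⁺ : ∀ {x} → 0 < x → x < p → x ∈ units
  ∈units⁺ 0<x (ℕ.s≤s x≤2n) = ∈-oneTo⁺ 0<x x≤2n

  ∈units⁻ : ∀ {x} → x ∈ units → 0 < x × x < p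
  ∈units⁻ x∈ = Product.map₂ ℕ.s≤s (∈-oneTo⁻ x∈)

  unit-≉0 : ∀ {x} → x ∈ units → ¬ + x ≈ 0ℤ
  unit-≉0 x∈ = residue-≉0 (proj₁ (∈units⁻ x∈)) (proj₂ (∈units⁻ x∈))

  quotient-exists : ∀ {a x} → ¬ + a ≈ 0ℤ → x ∈ units → Σ ℕ λ y → y ∈ units × + x * + y ≈ + a
  quotient-exists {a} {x} a≉0 x∈ with inverse-exists p-prime (proj₁ (∈units⁻ x∈)) (proj₂ (∈units⁻ x∈))
  ... | c , xc≈1 = y , ∈units⁺ 0<y (reduce<p (c * + a)) , xy≈a
    where
    y : ℕ
    y = reduce (c * + a)
    xy≈a : + x * + y ≈ + a
    xy≈a = begin
      + x * + y        ≈⟨ *-congˡ (+ x) (≈-sym (≈-reduce (c * + a))) ⟩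
      + x * (c * + a)  ≡⟨ ℤP.*-assoc (+ x) c (+ a) ⟨
      (+ x * c) * + a  ≈⟨ *-congʳ (+ a) xc≈1 ⟩
      1ℤ * + a         ≡⟨ ℤP.*-identityˡ (+ a) ⟩
      + a              ∎
      where open ≈-Reasoning
    0<y : 0 < y
    0<y = ℕP.n≢0⇒n>0 λ y≡0 →
      a≉0 (≈-trans (≈-sym xy≈a) (≡⇒≈ (trans (cong (λ t → + x * + t) y≡0) (ℤP.*-zeroʳ (+ x)))))

  -- Pairing x with a / x: (p - 1)! is a power of a times the product of the square roots of a.
  module Quotient (a : ℕ) (a≉0 : ¬ + a ≈ 0ℤ) where

    τ : ℕ → ℕ
    τ x = first (λ y → + x * + y ≈? + a) units

    τ-spec : ∀ {x} → x ∈ units → τ x ∈ units × + x * + τ x ≈ + a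
    τ-spec {x} x∈ = first-satisfies (λ y → + x * + y ≈? + a) units
                      (proj₁ (proj₂ (quotient-exists a≉0 x∈))) (proj₂ (proj₂ (quotient-exists a≉0 x∈)))

    τ-∈ : ∀ {x} → x ∈ units → τ x ∈ units
    τ-∈ = proj₁ ∘ τ-spec

    τ-unique : ∀ {x y} → x ∈ units → y ∈ units → + x * + y ≈ + a → τ x ≡ y
    τ-unique x∈ y∈ xy≈a = residue-injective (proj₂ (∈units⁻ (τ-∈ x∈))) (proj₂ (∈units⁻ y∈))
      (*-cancelˡ-≈ p-prime (unit-≉0 x∈) (≈-trans (proj₂ (τ-spec x∈)) (≈-sym xy≈a)))

    τ-involutive : ∀ {x} → x ∈ units → τ (τ x) ≡ x
    τ-involutive {x} x∈ = τ-unique (τ-∈ x∈) x∈ (≈-trans (≡⇒≈ (ℤP.*-comm (+ τ x) (+ x))) (proj₂ (τ-spec x∈)))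

    τ-fixed⇒square : ∀ {x} → x ∈ units → τ x ≡ x → + x * + x ≈ + a
    τ-fixed⇒square {x} x∈ τx≡x = subst (λ y → + x * + y ≈ + a) τx≡x (proj₂ (τ-spec x∈))

    pairs fixed : ℕ
    pairs = count (λ x → τ x <? x) units
    fixed = count (λ x → τ x ≟ x) units

    units-length : n ℕ.+ n ≡ (pairs ℕ.+ pairs) ℕ.+ fixed
    units-length = trans (sym (length-oneTo (n ℕ.+ n))) (length-involution units-unique τ-∈ τ-involutive)

    fixed-product : ℤ
    fixed-product = big (λ x → select (τ x ≟ x) (+ x)) units

    factorial≈ : factorial (n ℕ.+ n) ≈ (+ a) ^ pairs * fixed-product
    factorial≈ = begin
      factorial (n ℕ.+ n)                                           ≡⟨ big-involution units-unique τ-∈ τ-involutive (λ i → + i) ⟩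
      big (λ x → select (τ x <? x) (+ x * + τ x)) units * fixed-product
        ≈⟨ *-congʳ fixed-product (big-≈ units λ {x} x∈ → select-≈ (τ x <? x) (proj₂ (τ-spec x∈))) ⟩
      big (λ x → select (τ x <? x) (+ a)) units * fixed-product  ≡⟨ cong (_* fixed-product) (big-select-const _ (+ a) units) ⟩
      (+ a) ^ pairs * fixed-product                              ∎
      where open ≈-Reasoning

    product-units-nonresidue : (∀ {x} → x ∈ units → ¬ + x * + x ≈ + a) → factorial (n ℕ.+ n) ≈ (+ a) ^ n
    product-units-nonresidue nonresidue = begin
      factorial (n ℕ.+ n)            ≈⟨ factorial≈ ⟩
      (+ a) ^ pairs * fixed-product  ≡⟨ cong₂ (λ k t → (+ a) ^ k * t) pairs≡n fixed-product≡1 ⟩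
      (+ a) ^ n * 1ℤ                 ≡⟨ ℤP.*-identityʳ _ ⟩
      (+ a) ^ n                      ∎
      where
      open ≈-Reasoning
      no-fixed-point : ∀ {x} → x ∈ units → τ x ≢ x
      no-fixed-point x∈ = nonresidue x∈ ∘ τ-fixed⇒square x∈
      fixed-product≡1 : fixed-product ≡ 1ℤ
      fixed-product≡1 = big-ε _ units λ {x} x∈ → select-no (τ x ≟ x) (+ x) (no-fixed-point x∈)
      fixed≡0 : fixed ≡ 0
      fixed≡0 = Sumℕ.big-ε _ units λ {x} x∈ → Sumℕ.select-no (τ x ≟ x) 1 (no-fixed-point x∈)
      pairs≡n : pairs ≡ n
      pairs≡n = double-injective (sym (trans units-length
        (trans (cong ((pairs ℕ.+ pairs) ℕ.+_) fixed≡0) (ℕP.+-identityʳ (pairs ℕ.+ pairs)))))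

    module _ {x₀} (x₀∈ : x₀ ∈ units) (x₀²≈a : + x₀ * + x₀ ≈ + a) where

      private
        x₀<p : x₀ < p
        x₀<p = proj₂ (∈units⁻ x₀∈)

        x₁ : ℕ
        x₁ = p ∸ x₀

        x₁∈ : x₁ ∈ units
        x₁∈ = ∈units⁺ (ℕP.m<n⇒0<n∸m x₀<p) (ℕP.∸-monoʳ-< (proj₁ (∈units⁻ x₀∈)) (ℕP.<⇒≤ x₀<p))

        x₁≈-x₀ : + x₁ ≈ - + x₀
        x₁≈-x₀ = ≈-∸ (ℕP.<⇒≤ x₀<p)

        x₀≢x₁ : x₀ ≢ x₁
        x₀≢x₁ x₀≡x₁ = odd≢even x₀ n (trans (sym (ℕP.m∸n+n≡m (ℕP.<⇒≤ x₀<p))) (cong (ℕ._+ x₀) (sym x₀≡x₁)))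

        x₁²≈a : + x₁ * + x₁ ≈ + a
        x₁²≈a = ≈-trans (*-cong x₁≈-x₀ x₁≈-x₀) (≈-trans (≡⇒≈ (lemma (+ x₀))) x₀²≈a)
          where lemma : ∀ x → - x * - x ≡ x * x
                lemma = solve-∀

        only-two-fixed-points : ∀ {x} → x ∈ units → x ≢ x₀ → x ≢ x₁ → τ x ≢ x
        only-two-fixed-points {x} x∈ x≢x₀ x≢x₁ τx≡x =
          [ x≢x₀ ∘ residue-injective x<p x₀<p
          , (λ x≈-x₀ → x≢x₁ (residue-injective x<p (proj₂ (∈units⁻ x₁∈)) (≈-trans x≈-x₀ (≈-sym x₁≈-x₀))))
          ]′ (square≈square⇒≈± p-prime (≈-trans (τ-fixed⇒square x∈ τx≡x) (≈-sym x₀²≈a)))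
          where
          x<p : x < p
          x<p = proj₂ (∈units⁻ x∈)

        fixed-product≈-a : fixed-product ≈ - + a
        fixed-product≈-a = begin
          fixed-product     ≡⟨ big-two-point _ units-unique x₀∈ x₁∈ x₀≢x₁ (λ {x} x∈ x≢x₀ x≢x₁ →
                                 select-no (τ x ≟ x) (+ x) (only-two-fixed-points x∈ x≢x₀ x≢x₁)) ⟩
          select (τ x₀ ≟ x₀) (+ x₀) * select (τ x₁ ≟ x₁) (+ x₁)
                            ≡⟨ cong₂ _*_ (select-yes (τ x₀ ≟ x₀) _ (τ-unique x₀∈ x₀∈ x₀²≈a))
                                         (select-yes (τ x₁ ≟ x₁) _ (τ-unique x₁∈ x₁∈ x₁²≈a)) ⟩
          + x₀ * + x₁      ≈⟨ *-congˡ (+ x₀) x₁≈-x₀ ⟩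
          + x₀ * - + x₀    ≡⟨ ℤP.neg-distribʳ-* (+ x₀) (+ x₀) ⟨
          - (+ x₀ * + x₀)  ≈⟨ -‿cong x₀²≈a ⟩
          - + a            ∎
          where open ≈-Reasoning

        fixed≡2 : fixed ≡ 2
        fixed≡2 = trans (Sumℕ.big-two-point _ units-unique x₀∈ x₁∈ x₀≢x₁ (λ {x} x∈ x≢x₀ x≢x₁ →
                           Sumℕ.select-no (τ x ≟ x) 1 (only-two-fixed-points x∈ x≢x₀ x≢x₁)))
                        (cong₂ ℕ._+_ (Sumℕ.select-yes (τ x₀ ≟ x₀) 1 (τ-unique x₀∈ x₀∈ x₀²≈a))
                                     (Sumℕ.select-yes (τ x₁ ≟ x₁) 1 (τ-unique x₁∈ x₁∈ x₁²≈a)))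

        n≡1+pairs : n ≡ suc pairs
        n≡1+pairs = double-injective (begin
          n ℕ.+ n                      ≡⟨ units-length ⟩
          (pairs ℕ.+ pairs) ℕ.+ fixed  ≡⟨ cong ((pairs ℕ.+ pairs) ℕ.+_) fixed≡2 ⟩
          (pairs ℕ.+ pairs) ℕ.+ 2      ≡⟨ lemma pairs ⟩
          suc pairs ℕ.+ suc pairs      ∎)
          where
          open ≡-Reasoning
          lemma : ∀ k → (k ℕ.+ k) ℕ.+ 2 ≡ suc k ℕ.+ suc k
          lemma = ℕSolver.solve-∀

      product-units-residue : factorial (n ℕ.+ n) ≈ - ((+ a) ^ n)
      product-units-residue = begin
        factorial (n ℕ.+ n)            ≈⟨ factorial≈ ⟩
        (+ a) ^ pairs * fixed-product  ≈⟨ *-congˡ ((+ a) ^ pairs) fixed-product≈-a ⟩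
        (+ a) ^ pairs * - + a          ≡⟨ lemma ((+ a) ^ pairs) (+ a) ⟩
        - (+ a * (+ a) ^ pairs)        ≡⟨ cong (λ k → - ((+ a) ^ k)) n≡1+pairs ⟨
        - ((+ a) ^ n)                  ∎
        where
        open ≈-Reasoning
        lemma : ∀ A a → A * - a ≡ - (a * A)
        lemma = solve-∀

  1<p : 1 < p
  1<p = ℕ.nonTrivial⇒n>1 p {{prime⇒nonTrivial p-prime}}

  wilson : factorial (n ℕ.+ n) ≈ - 1ℤ
  wilson = begin
    factorial (n ℕ.+ n)  ≈⟨ Quotient.product-units-residue 1 1≉0 1∈units (≈-refl {1ℤ}) ⟩
    - (1ℤ ^ n)           ≡⟨ cong -_ (ℤP.^-zeroˡ n) ⟩
    - 1ℤ                 ∎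
    where
    open ≈-Reasoning
    1∈units : 1 ∈ units
    1∈units = ∈units⁺ (ℕ.s≤s ℕ.z≤n) 1<p
    1≉0 : ¬ 1ℤ ≈ 0ℤ
    1≉0 = unit-≉0 1∈units

  euler-criterion : ∀ a → ¬ p ℕD.∣ a → (+ a) ^ n ≈ legendre p a
  euler-criterion a p∤a with p ℕD.∣? a
  ... | yes p∣a = ⊥-elim (p∤a p∣a)
  ... | no _ with isSquareMod? p a
  ...   | yes square = begin
    (+ a) ^ n              ≡⟨ ℤP.neg-involutive ((+ a) ^ n) ⟨
    - - ((+ a) ^ n)        ≈⟨ -‿cong (≈-sym (Quotient.product-units-residue a (∤⇒≉0 p∤a) x∈ x²≈a)) ⟩
    - factorial (n ℕ.+ n)  ≈⟨ -‿cong wilson ⟩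
    1ℤ                     ∎
    where
    open ≈-Reasoning
    root = find square
    x = proj₁ root
    x²≈a : + x * + x ≈ + a
    x²≈a = ≈-trans (≡⇒≈ (sym (ℤP.pos-* x x))) (≡[mod]⇒≈ (proj₂ (proj₂ root)))
    x∈ : x ∈ units
    x∈ = ∈units⁺ (ℕP.n≢0⇒n>0 λ x≡0 → ∤⇒≉0 p∤a (≈-trans (≈-sym x²≈a) (≡⇒≈ (cong (λ t → + t * + t) x≡0))))
                 (∈-upTo⁻ (proj₁ (proj₂ root)))
  ...   | no nonsquare = begin
    (+ a) ^ n            ≈⟨ Quotient.product-units-nonresidue a (∤⇒≉0 p∤a) nonresidue ⟨
    factorial (n ℕ.+ n)  ≈⟨ wilson ⟩
    - 1ℤ                 ∎
    where
    open ≈-Reasoning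
    nonresidue : ∀ {x} → x ∈ units → ¬ + x * + x ≈ + a
    nonresidue {x} x∈ x²≈a =
      nonsquare (lose (∈-upTo⁺ (proj₂ (∈units⁻ x∈))) (≈⇒≡[mod] (≈-trans (≡⇒≈ (ℤP.pos-* x x)) x²≈a)))

module _ {A : Set} where

  ℤproduct-map-filter : ∀ {Q : A → Set} (Q? : ∀ x → Dec (Q x)) (f : A → ℤ) xs →
                        ℤproduct (map f (filter Q? xs)) ≡ ℤproduct (map (λ x → select (Q? x) (f x)) xs)
  ℤproduct-map-filter Q? f []       = refl
  ℤproduct-map-filter Q? f (x ∷ xs) with Q? x
  ... | yes _ = cong (f x *_) (ℤproduct-map-filter Q? f xs)
  ... | no _  = trans (ℤproduct-map-filter Q? f xs) (sym (ℤP.*-identityˡ _))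

  ℤproduct-map-++ : ∀ (f : A → ℤ) xs ys → ℤproduct (map f (xs ++ ys)) ≡ ℤproduct (map f xs) * ℤproduct (map f ys)
  ℤproduct-map-++ f []       ys = sym (ℤP.*-identityˡ _)
  ℤproduct-map-++ f (x ∷ xs) ys = trans (cong (f x *_) (ℤproduct-map-++ f xs ys)) (sym (ℤP.*-assoc (f x) _ _))

  ℤproduct-map-concatMap : ∀ (f : A → ℤ) (g : ℕ → List A) js →
                           ℤproduct (map f (concatMap g js)) ≡ big (λ j → ℤproduct (map f (g j))) js
  ℤproduct-map-concatMap f g []       = refl
  ℤproduct-map-concatMap f g (j ∷ js) =
    trans (ℤproduct-map-++ f (g j) (concatMap g js)) (cong (ℤproduct (map f (g j)) *_) (ℤproduct-map-concatMap f g js))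

ℤproduct-map : ∀ (f : ℕ → ℤ) js → ℤproduct (map f js) ≡ big f js
ℤproduct-map f []       = refl
ℤproduct-map f (j ∷ js) = cong (f j *_) (ℤproduct-map f js)

cor27Product≡big : ∀ p → cor27Product p ≡
  big (λ j → big (λ i → select (¬? (p ℕD.∣? (i ℕ.* i ℕ.+ j ℕ.* j))) (+ (j ℕ.* j) - + (i ℕ.* i))) (oneTo (ℕ.pred j)))
      (oneTo ((p ∸ 1) / 2))
cor27Product≡big p = begin
  cor27Product p
    ≡⟨ ℤproduct-map-filter _ _ (pairsLt ((p ∸ 1) / 2)) ⟩
  ℤproduct (map factor (pairsLt ((p ∸ 1) / 2)))
    ≡⟨ ℤproduct-map-concatMap factor (λ j → map (λ i → i , j) (oneTo (ℕ.pred j))) (oneTo ((p ∸ 1) / 2)) ⟩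
  big (λ j → ℤproduct (map factor (map (λ i → i , j) (oneTo (ℕ.pred j))))) (oneTo ((p ∸ 1) / 2))
    ≡⟨ big-cong (oneTo ((p ∸ 1) / 2)) (λ {j} _ → trans (cong ℤproduct (sym (ListP.map-∘ (oneTo (ℕ.pred j)))))
                                                       (ℤproduct-map _ (oneTo (ℕ.pred j)))) ⟩
  big (λ j → big (λ i → select (¬? (p ℕD.∣? (i ℕ.* i ℕ.+ j ℕ.* j))) (+ (j ℕ.* j) - + (i ℕ.* i))) (oneTo (ℕ.pred j)))
      (oneTo ((p ∸ 1) / 2)) ∎
  where
  open ≡-Reasoning
  factor : ℕ × ℕ → ℤ
  factor (i , j) = select (¬? (p ℕD.∣? (i ℕ.* i ℕ.+ j ℕ.* j))) (+ (j ℕ.* j) - + (i ℕ.* i))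

legendre²≡1 : ∀ p a → ¬ p ℕD.∣ a → legendre p a * legendre p a ≡ 1ℤ
legendre²≡1 p a p∤a with p ℕD.∣? a
... | yes p∣a = ⊥-elim (p∤a p∣a)
... | no _ with isSquareMod? p a
...   | yes _ = refl
...   | no _  = refl

module PythagoreanPrime (m : ℕ) (p-prime : Prime (suc ((m ℕ.+ m) ℕ.+ (m ℕ.+ m)))) where

  n : ℕ
  n = m ℕ.+ m

  open OddPrime n p-prime public

  half-factorial-square : factorial n * factorial n ≈ - 1ℤ
  half-factorial-square = begin
    factorial n * factorial n                 ≡⟨ cong (factorial n *_) (ℤP.*-identityˡ (factorial n)) ⟨
    factorial n * (1ℤ * factorial n)          ≡⟨ cong (λ s → factorial n * (s * factorial n)) (-1^-even m) ⟨
    factorial n * ((- 1ℤ) ^ n * factorial n)  ≈⟨ factorial-reflection n n refl ⟩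
    factorial (n ℕ.+ n)                       ≈⟨ wilson ⟩
    - 1ℤ                                      ∎
    where open ≈-Reasoning

  odd-factorials : ∀ t s → suc (t ℕ.+ s) ≡ n → factorial (suc (t ℕ.+ t)) * factorial (suc (s ℕ.+ s)) ≈ 1ℤ
  odd-factorials t s t+s+1≡n = begin
    T * S                                 ≡⟨ lemma T S ⟩
    - (T * (- 1ℤ * S))                    ≡⟨ cong (λ z → - (T * (z * S))) (-1^-odd s) ⟨
    - (T * ((- 1ℤ) ^ suc (s ℕ.+ s) * S))  ≈⟨ -‿cong (factorial-reflection (suc (s ℕ.+ s)) (suc (t ℕ.+ t)) sum≡p-1) ⟩
    - factorial (n ℕ.+ n)                 ≈⟨ -‿cong wilson ⟩
    1ℤ                                    ∎
    where
    open ≈-Reasoning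
    T S : ℤ
    T = factorial (suc (t ℕ.+ t))
    S = factorial (suc (s ℕ.+ s))
    lemma : ∀ T S → T * S ≡ - (T * (- 1ℤ * S))
    lemma = solve-∀
    sum≡p-1 : suc (t ℕ.+ t) ℕ.+ suc (s ℕ.+ s) ≡ n ℕ.+ n
    sum≡p-1 = trans (regroup t s) (cong (λ k → k ℕ.+ k) t+s+1≡n)
      where regroup : ∀ t s → suc (t ℕ.+ t) ℕ.+ suc (s ℕ.+ s) ≡ suc (t ℕ.+ s) ℕ.+ suc (t ℕ.+ s)
            regroup = ℕSolver.solve-∀

  odd-factorials-product : big (λ j → factorial (suc (ℕ.pred j ℕ.+ ℕ.pred j))) (oneTo n) ≈ 1ℤ
  odd-factorials-product = begin
    big g (oneTo n)
      ≡⟨ big-involution (oneTo-unique n) reflect-∈ reflect-involutive g ⟩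
    big (λ j → select (τ j <? j) (g j * g (τ j))) (oneTo n) * big (λ j → select (τ j ≟ j) (g j)) (oneTo n)
      ≈⟨ *-cong (big-≈ (oneTo n) λ {j} j∈ → select-≈ (τ j <? j) (partners j∈))
                (≡⇒≈ (big-ε _ (oneTo n) λ {j} j∈ → select-no (τ j ≟ j) (g j) (no-fixed-point j∈))) ⟩
    big (λ j → select (τ j <? j) 1ℤ) (oneTo n) * 1ℤ
      ≡⟨ cong (_* 1ℤ) (big-ε _ (oneTo n) λ {j} _ → select-ε (τ j <? j)) ⟩
    1ℤ ∎
    where
    open ≈-Reasoning
    g : ℕ → ℤ
    g j = factorial (suc (ℕ.pred j ℕ.+ ℕ.pred j))
    τ : ℕ → ℕ
    τ j = suc n ∸ j
    partners : ∀ {j} → j ∈ oneTo n → g j * g (τ j) ≈ 1ℤ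
    partners {zero}  j∈ = ⊥-elim (ℕP.<-irrefl refl (proj₁ (∈-oneTo⁻ j∈)))
    partners {suc t} j∈ = subst (λ k → g (suc t) * g k ≈ 1ℤ) (sym τj≡1+s) (odd-factorials t s (ℕP.m+[n∸m]≡n t<n))
      where
      t<n : suc t ≤ n
      t<n = proj₂ (∈-oneTo⁻ j∈)
      s : ℕ
      s = n ∸ suc t
      τj≡1+s : τ (suc t) ≡ suc s
      τj≡1+s = ℕP.+-∸-assoc 1 t<n
    no-fixed-point : ∀ {j} → j ∈ oneTo n → τ j ≢ j
    no-fixed-point {j} j∈ τj≡j =
      odd≢even j m (trans (sym (ℕP.m∸n+n≡m (ℕP.m≤n⇒m≤1+n (proj₂ (∈-oneTo⁻ j∈))))) (cong (ℕ._+ j) τj≡j))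

  squareDifferences-product : big squareDifferences (oneTo n) * factorial n ≈ 1ℤ
  squareDifferences-product = begin
    big squareDifferences (oneTo n) * factorial n                  ≡⟨ big-∙ squareDifferences (λ j → + j) (oneTo n) ⟨
    big (λ j → squareDifferences j * + j) (oneTo n)                ≡⟨ big-cong (oneTo n) (λ {j} j∈ → odd-factorial j (proj₁ (∈-oneTo⁻ j∈))) ⟩
    big (λ j → factorial (suc (ℕ.pred j ℕ.+ ℕ.pred j))) (oneTo n)  ≈⟨ odd-factorials-product ⟩
    1ℤ                                                             ∎
    where
    open ≈-Reasoning
    odd-factorial : ∀ j → 0 < j → squareDifferences j * + j ≡ factorial (suc (ℕ.pred j ℕ.+ ℕ.pred j))
    odd-factorial (suc t) _ = squareDifferences-suc t

  -- A square root of -1 and the pairing σ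

  2<p : 2 < p
  2<p = at-least-5 m 1<p
    where
    at-least-5 : ∀ k → 1 < suc ((k ℕ.+ k) ℕ.+ (k ℕ.+ k)) → 2 < suc ((k ℕ.+ k) ℕ.+ (k ℕ.+ k))
    at-least-5 zero    (ℕ.s≤s ())
    at-least-5 (suc k) _ = ℕ.s≤s (ℕ.s≤s (ℕP.≤-trans (ℕ.s≤s ℕ.z≤n) (ℕP.m≤n+m (suc (k ℕ.+ suc k)) (k ℕ.+ suc k))))

  1≉-1 : ¬ 1ℤ ≈ - 1ℤ
  1≉-1 1≈-1 = residue-≉0 (ℕ.s≤s ℕ.z≤n) 2<p (+-cong 1≈-1 (≈-refl {1ℤ}))

  p-1≈-1 : + (n ℕ.+ n) ≈ - 1ℤ
  p-1≈-1 = ≈-∸ (ℕ.s≤s ℕ.z≤n)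

  sqrt-1-exists : Σ ℕ λ k → k ∈ units × + k * + k ≈ - 1ℤ
  sqrt-1-exists with any? (λ x → + x * + x ≈? + (n ℕ.+ n)) units
  ... | yes root = let (k , k∈ , k²≈-1) = find root in k , k∈ , ≈-trans k²≈-1 p-1≈-1
  ... | no nonresidue = ⊥-elim (1≉-1 (begin
    1ℤ                 ≡⟨ -1^-even m ⟨
    (- 1ℤ) ^ n         ≈⟨ ^-cong n p-1≈-1 ⟨
    (+ (n ℕ.+ n)) ^ n  ≈⟨ Quotient.product-units-nonresidue (n ℕ.+ n) (unit-≉0 p-1∈)
                              (λ x∈ x²≈-1 → nonresidue (lose x∈ x²≈-1)) ⟨
    factorial (n ℕ.+ n)  ≈⟨ wilson ⟩
    - 1ℤ                 ∎))
    where
    open ≈-Reasoning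
    p-1∈ : n ℕ.+ n ∈ units
    p-1∈ = ∈units⁺ (ℕ.≤-pred 1<p) (ℕP.n<1+n (n ℕ.+ n))

  halves : List ℕ
  halves = oneTo n

  halves-unique : Unique halves
  halves-unique = oneTo-unique n

  n<p : n < p
  n<p = ℕ.s≤s (ℕP.m≤m+n n n)

  half<p : ∀ {x} → x ∈ halves → x < p
  half<p x∈ = ℕP.≤-<-trans (proj₂ (∈-oneTo⁻ x∈)) n<p

  half⇒unit : ∀ {x} → x ∈ halves → x ∈ units
  half⇒unit x∈ = ∈units⁺ (proj₁ (∈-oneTo⁻ x∈)) (half<p x∈)

  -- The representative of ±y in [1, n].
  fold : ℕ → ℕ
  fold y with y ≤? n
  ... | yes _ = y
  ... | no _  = p ∸ y

  fold-small : ∀ {y} → y ≤ n → fold y ≡ y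
  fold-small {y} y≤n with y ≤? n
  ... | yes _   = refl
  ... | no y≰n  = ⊥-elim (y≰n y≤n)

  fold-large : ∀ {y} → n < y → fold y ≡ p ∸ y
  fold-large {y} n<y with y ≤? n
  ... | yes y≤n = ⊥-elim (ℕP.<⇒≱ n<y y≤n)
  ... | no _    = refl

  fold-complement : ∀ {y A} → y ∈ halves → A ℕ.+ y ≡ p → fold A ≡ y
  fold-complement {y} {A} y∈ A+y≡p = begin
    fold A           ≡⟨ fold-large n<A ⟩
    p ∸ A            ≡⟨ cong (p ∸_) (trans (sym (ℕP.m+n∸n≡m A y)) (cong (_∸ y) A+y≡p)) ⟩
    p ∸ (p ∸ y)      ≡⟨ ℕP.m∸[m∸n]≡n (ℕP.<⇒≤ (half<p y∈)) ⟩
    y                ∎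
    where
    open ≡-Reasoning
    n<A : n < A
    n<A = ℕP.≰⇒> λ A≤n → ℕP.<-irrefl A+y≡p (ℕ.s≤s (ℕP.+-mono-≤ A≤n (proj₂ (∈-oneTo⁻ y∈))))

  fold-∈ : ∀ {y} → 0 < y → y < p → fold y ∈ halves
  fold-∈ {y} 0<y y<p with y ≤? n
  ... | yes y≤n = ∈-oneTo⁺ 0<y y≤n
  ... | no y≰n  = ∈-oneTo⁺ (ℕP.m<n⇒0<n∸m y<p)
                    (subst (p ∸ y ≤_) (ℕP.m+n∸n≡m n n) (ℕP.∸-monoʳ-≤ p (ℕP.≰⇒> y≰n)))

  fold-square : ∀ {y} → y < p → + fold y * + fold y ≈ + y * + y
  fold-square {y} y<p with y ≤? n
  ... | yes _ = ≈-refl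
  ... | no _  = ≈-trans (*-cong (≈-∸ (ℕP.<⇒≤ y<p)) (≈-∸ (ℕP.<⇒≤ y<p))) (≡⇒≈ (lemma (+ y)))
    where lemma : ∀ x → - x * - x ≡ x * x
          lemma = solve-∀

  opaque
    k : ℕ
    k = proj₁ sqrt-1-exists

    k∈ : k ∈ units
    k∈ = proj₁ (proj₂ sqrt-1-exists)

    k²≈-1 : + k * + k ≈ - 1ℤ
    k²≈-1 = proj₂ (proj₂ sqrt-1-exists)

  σ : ℕ → ℕ
  σ x = fold (reduce (+ k * + x))

  σ-∈ : ∀ {x} → x ∈ halves → σ x ∈ halves
  σ-∈ {x} x∈ = fold-∈ (ℕP.n≢0⇒n>0 kx≢0) (reduce<p (+ k * + x))
    where
    kx≢0 : reduce (+ k * + x) ≢ 0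
    kx≢0 kx≡0 = *-≉0 p-prime (unit-≉0 k∈) (unit-≉0 (half⇒unit x∈))
                  (≈-trans (≈-reduce (+ k * + x)) (≡⇒≈ (cong +_ kx≡0)))

  σ-square : ∀ {x} → x ∈ halves → + σ x * + σ x ≈ - (+ x * + x)
  σ-square {x} x∈ = begin
    + σ x * + σ x              ≈⟨ fold-square (reduce<p (+ k * + x)) ⟩
    + reduce kx * + reduce kx  ≈⟨ *-cong (≈-reduce kx) (≈-reduce kx) ⟨
    kx * kx                    ≡⟨ lemma (+ k) (+ x) ⟩
    (+ k * + k) * (+ x * + x)  ≈⟨ *-congʳ (+ x * + x) k²≈-1 ⟩
    - 1ℤ * (+ x * + x)         ≡⟨ ℤP.-1*i≡-i (+ x * + x) ⟩
    - (+ x * + x)              ∎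
    where
    open ≈-Reasoning
    kx : ℤ
    kx = + k * + x
    lemma : ∀ k x → (k * x) * (k * x) ≡ (k * k) * (x * x)
    lemma = solve-∀

  σ-unique : ∀ {x y} → x ∈ halves → y ∈ halves → + x * + x + + y * + y ≈ 0ℤ → y ≡ σ x
  σ-unique {x} {y} x∈ y∈ x²+y²≈0 =
    [ residue-injective (half<p y∈) (half<p (σ-∈ x∈)) , ⊥-elim ∘ residue-≉0 0<y+σx y+σx<p ∘ y+σx≈0 ]′
      (square≈square⇒≈± p-prime (≈-trans (+≈0⇒≈- x²+y²≈0) (≈-sym (σ-square x∈))))
    where
    y+σx≈0 : + y ≈ - + σ x → + (y ℕ.+ σ x) ≈ 0ℤ
    y+σx≈0 y≈-σx = ≈-trans (≡⇒≈ (trans (ℤP.pos-+ y (σ x)) (ℤP.+-comm (+ y) (+ σ x)))) (≈-⇒+≈0 y≈-σx)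
    0<y+σx : 0 < y ℕ.+ σ x
    0<y+σx = ℕP.<-≤-trans (proj₁ (∈-oneTo⁻ y∈)) (ℕP.m≤m+n y (σ x))
    y+σx<p : y ℕ.+ σ x < p
    y+σx<p = ℕ.s≤s (ℕP.+-mono-≤ (proj₂ (∈-oneTo⁻ y∈)) (proj₂ (∈-oneTo⁻ (σ-∈ x∈))))

  σ-involutive : ∀ {x} → x ∈ halves → σ (σ x) ≡ x
  σ-involutive {x} x∈ = sym (σ-unique (σ-∈ x∈) x∈
    (≈-trans (≡⇒≈ (ℤP.+-comm (+ σ x * + σ x) (+ x * + x))) (≈-⇒+≈0 (σ-square x∈))))

  σ-no-fixed-point : ∀ {x} → x ∈ halves → σ x ≢ x
  σ-no-fixed-point {x} x∈ σx≡x = *-≉0 p-prime 2≉0 (*-≉0 p-prime x≉0 x≉0) (begin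
    + 2 * (+ x * + x)          ≡⟨ lemma (+ x * + x) ⟩
    + x * + x + + x * + x      ≡⟨ cong (λ z → + x * + x + + z * + z) σx≡x ⟨
    + x * + x + + σ x * + σ x  ≈⟨ ≈-⇒+≈0 (σ-square x∈) ⟩
    0ℤ                         ∎)
    where
    open ≈-Reasoning
    2≉0 : ¬ + 2 ≈ 0ℤ
    2≉0 = residue-≉0 (ℕ.s≤s ℕ.z≤n) 2<p
    x≉0 : ¬ + x ≈ 0ℤ
    x≉0 = unit-≉0 (half⇒unit x∈)
    lemma : ∀ z → + 2 * z ≡ z + z
    lemma = solve-∀

  squares-of-sum-and-difference : ∀ {x i} → i ≤ x →
    + (x ℕ.+ i) * + (x ℕ.+ i) + + (x ∸ i) * + (x ∸ i) ≡ + 2 * (+ x * + x + + i * + i)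
  squares-of-sum-and-difference {x} {i} i≤x = begin
    + (x ℕ.+ i) * + (x ℕ.+ i) + + (x ∸ i) * + (x ∸ i)      ≡⟨ cong₂ (λ s d → s * s + d * d) (ℤP.pos-+ x i) (pos-∸ i≤x) ⟩
    (+ x + + i) * (+ x + + i) + (+ x - + i) * (+ x - + i)  ≡⟨ lemma (+ x) (+ i) ⟩
    + 2 * (+ x * + x + + i * + i)                          ∎
    where
    open ≡-Reasoning
    lemma : ∀ x i → (x + i) * (x + i) + (x - i) * (x - i) ≡ + 2 * (x * x + i * i)
    lemma = solve-∀

  large? : ∀ x → Dec (σ x < x)
  large? x = σ x <? x

  -- ρ sends the larger element x of the pair {x, σ x} to the larger element of the pair {±(x + σ x), x - σ x}.
  ρ : ℕ → ℕ
  ρ x with large? x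
  ... | yes _ = fold (x ℕ.+ σ x)
  ... | no _  = x

  sum<p : ∀ {x} → x ∈ halves → x ℕ.+ σ x < p
  sum<p x∈ = ℕ.s≤s (ℕP.+-mono-≤ (proj₂ (∈-oneTo⁻ x∈)) (proj₂ (∈-oneTo⁻ (σ-∈ x∈))))

  module _ {x} (x∈ : x ∈ halves) (σx<x : σ x < x) where

    private
      σx∈ : σ x ∈ halves
      σx∈ = σ-∈ x∈

    ρ-large : ρ x ≡ fold (x ℕ.+ σ x)
    ρ-large with large? x
    ... | yes _     = refl
    ... | no σx≮x  = ⊥-elim (σx≮x σx<x)

    fold-sum-∈ : fold (x ℕ.+ σ x) ∈ halves
    fold-sum-∈ = fold-∈ (ℕP.<-≤-trans (proj₁ (∈-oneTo⁻ x∈)) (ℕP.m≤m+n x (σ x))) (sum<p x∈)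

    σ-fold-sum : σ (fold (x ℕ.+ σ x)) ≡ x ∸ σ x
    σ-fold-sum = sym (σ-unique fold-sum-∈ difference-∈ (begin
      + y * + y + + d * + d                      ≈⟨ +-cong (fold-square (sum<p x∈)) ≈-refl ⟩
      + (x ℕ.+ σ x) * + (x ℕ.+ σ x) + + d * + d  ≡⟨ squares-of-sum-and-difference (ℕP.<⇒≤ σx<x) ⟩
      + 2 * (+ x * + x + + σ x * + σ x)          ≈⟨ *-congˡ (+ 2) (≈-⇒+≈0 (σ-square x∈)) ⟩
      + 2 * 0ℤ                                   ≡⟨ ℤP.*-zeroʳ (+ 2) ⟩
      0ℤ                                         ∎))
      where
      open ≈-Reasoning
      y d : ℕ
      y = fold (x ℕ.+ σ x)
      d = x ∸ σ x
      difference-∈ : d ∈ halves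
      difference-∈ = ∈-oneTo⁺ (ℕP.m<n⇒0<n∸m σx<x) (ℕP.≤-trans (ℕP.m∸n≤m x (σ x)) (proj₂ (∈-oneTo⁻ x∈)))

    fold-sum-large : σ (fold (x ℕ.+ σ x)) < fold (x ℕ.+ σ x)
    fold-sum-large = subst (_< fold (x ℕ.+ σ x)) (sym σ-fold-sum) (difference<fold ((x ℕ.+ σ x) ≤? n))
      where
      x≤n : x ≤ n
      x≤n = proj₂ (∈-oneTo⁻ x∈)
      difference<fold : Dec (x ℕ.+ σ x ≤ n) → x ∸ σ x < fold (x ℕ.+ σ x)
      difference<fold (yes x+σx≤n) = subst (x ∸ σ x <_) (sym (fold-small x+σx≤n))
        (ℕP.≤-<-trans (ℕP.m∸n≤m x (σ x)) (ℕP.m<m+n x (proj₁ (∈-oneTo⁻ σx∈))))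
      difference<fold (no x+σx≰n)  = subst (x ∸ σ x <_) (sym (fold-large (ℕP.≰⇒> x+σx≰n)))
        (ℕP.m+n≤o⇒m≤o∸n (suc (x ∸ σ x)) (subst (_< p) (sym (m∸n+[m+n]≡m+m (ℕP.<⇒≤ σx<x))) (ℕ.s≤s (ℕP.+-mono-≤ x≤n x≤n))))

  ρ-small : ∀ {x} → ¬ σ x < x → ρ x ≡ x
  ρ-small {x} σx≮x with large? x
  ... | yes σx<x = ⊥-elim (σx≮x σx<x)
  ... | no _     = refl

  ρ-∈ : ∀ {x} → x ∈ halves → ρ x ∈ halves
  ρ-∈ {x} x∈ with large? x
  ... | yes σx<x = fold-sum-∈ x∈ σx<x
  ... | no _     = x∈

  fold-injective : ∀ {A B} → A < p → B < p → fold A ≡ fold B → A ≡ B ⊎ A ℕ.+ B ≡ p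
  fold-injective {A} {B} A<p B<p = cases (A ≤? n) (B ≤? n)
    where
    sum≡p : ∀ {C D} → D < p → C ≡ p ∸ D → C ℕ.+ D ≡ p
    sum≡p D<p C≡p∸D = trans (cong (ℕ._+ _) C≡p∸D) (ℕP.m∸n+n≡m (ℕP.<⇒≤ D<p))
    cases : Dec (A ≤ n) → Dec (B ≤ n) → fold A ≡ fold B → A ≡ B ⊎ A ℕ.+ B ≡ p
    cases (yes A≤n) (yes B≤n) eq = inj₁ (trans (sym (fold-small A≤n)) (trans eq (fold-small B≤n)))
    cases (no A≰n)  (no B≰n)  eq = inj₁ (ℕP.∸-cancelˡ-≡ (ℕP.<⇒≤ A<p) (ℕP.<⇒≤ B<p)
      (trans (sym (fold-large (ℕP.≰⇒> A≰n))) (trans eq (fold-large (ℕP.≰⇒> B≰n)))))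
    cases (yes A≤n) (no B≰n)  eq = inj₂ (sum≡p B<p (trans (sym (fold-small A≤n)) (trans eq (fold-large (ℕP.≰⇒> B≰n)))))
    cases (no A≰n)  (yes B≤n) eq = inj₂ (trans (ℕP.+-comm A B)
      (sum≡p A<p (trans (sym (fold-small B≤n)) (trans (sym eq) (fold-large (ℕP.≰⇒> A≰n))))))

  -- ρ x determines x - σ x (as σ (ρ x)) and x + σ x up to A ↦ p - A; together they determine x, and the
  -- case (x + σ x) + (y + σ y) = p is excluded by parity.
  ρ-injective-large : ∀ {x y} → x ∈ halves → y ∈ halves → σ x < x → σ y < y → ρ x ≡ ρ y → x ≡ y
  ρ-injective-large {x} {y} x∈ y∈ σx<x σy<y ρx≡ρy =
    [ equal-sums , ⊥-elim ∘ sums-add-to-p ]′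
      (fold-injective (sum<p x∈) (sum<p y∈) (trans (sym (ρ-large x∈ σx<x)) (trans ρx≡ρy (ρ-large y∈ σy<y))))
    where
    open ≡-Reasoning
    d : ℕ → ℕ
    d z = z ∸ σ z
    d≡ : d x ≡ d y
    d≡ = trans (sym (σ-fold-sum x∈ σx<x))
               (trans (cong σ (trans (sym (ρ-large x∈ σx<x)) (trans ρx≡ρy (ρ-large y∈ σy<y)))) (σ-fold-sum y∈ σy<y))
    equal-sums : x ℕ.+ σ x ≡ y ℕ.+ σ y → x ≡ y
    equal-sums A≡B = double-injective (begin
      x ℕ.+ x              ≡⟨ m∸n+[m+n]≡m+m (ℕP.<⇒≤ σx<x) ⟨
      d x ℕ.+ (x ℕ.+ σ x)  ≡⟨ cong₂ ℕ._+_ d≡ A≡B ⟩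
      d y ℕ.+ (y ℕ.+ σ y)  ≡⟨ m∸n+[m+n]≡m+m (ℕP.<⇒≤ σy<y) ⟩
      y ℕ.+ y              ∎)
    regroup : ∀ d n → suc ((d ℕ.+ n) ℕ.+ (d ℕ.+ n)) ≡ (d ℕ.+ d) ℕ.+ suc (n ℕ.+ n)
    regroup = ℕSolver.solve-∀
    interchange : ∀ a b c e → (a ℕ.+ b) ℕ.+ (c ℕ.+ e) ≡ (a ℕ.+ c) ℕ.+ (b ℕ.+ e)
    interchange = ℕSolver.solve-∀
    sums-add-to-p : (x ℕ.+ σ x) ℕ.+ (y ℕ.+ σ y) ≡ p → ⊥
    sums-add-to-p A+B≡p = odd≢even (x ℕ.+ y) (d x ℕ.+ n) (begin
      suc ((d x ℕ.+ n) ℕ.+ (d x ℕ.+ n))                ≡⟨ regroup (d x) n ⟩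
      (d x ℕ.+ d x) ℕ.+ p                              ≡⟨ cong₂ (λ t u → (d x ℕ.+ t) ℕ.+ u) d≡ (sym A+B≡p) ⟩
      (d x ℕ.+ d y) ℕ.+ ((x ℕ.+ σ x) ℕ.+ (y ℕ.+ σ y))  ≡⟨ interchange (d x) (d y) (x ℕ.+ σ x) (y ℕ.+ σ y) ⟩
      (d x ℕ.+ (x ℕ.+ σ x)) ℕ.+ (d y ℕ.+ (y ℕ.+ σ y))
        ≡⟨ cong₂ ℕ._+_ (m∸n+[m+n]≡m+m (ℕP.<⇒≤ σx<x)) (m∸n+[m+n]≡m+m (ℕP.<⇒≤ σy<y)) ⟩
      (x ℕ.+ x) ℕ.+ (y ℕ.+ y)  ≡⟨ interchange x x y y ⟩
      (x ℕ.+ y) ℕ.+ (x ℕ.+ y)  ∎)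

  ρ-injective : ∀ {x y} → x ∈ halves → y ∈ halves → ρ x ≡ ρ y → x ≡ y
  ρ-injective {x} {y} x∈ y∈ = cases (large? x) (large? y)
    where
    image-large : ∀ {z w} → z ∈ halves → σ z < z → ¬ σ w < w → ρ z ≡ ρ w → ⊥
    image-large {z} {w} z∈ σz<z σw≮w ρz≡ρw =
      σw≮w (subst (λ v → σ v < v) (trans (sym (ρ-large z∈ σz<z)) (trans ρz≡ρw (ρ-small σw≮w))) (fold-sum-large z∈ σz<z))
    cases : Dec (σ x < x) → Dec (σ y < y) → ρ x ≡ ρ y → x ≡ y
    cases (yes σx<x) (yes σy<y) = ρ-injective-large x∈ y∈ σx<x σy<y
    cases (yes σx<x) (no σy≮y)  = ⊥-elim ∘ image-large x∈ σx<x σy≮y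
    cases (no σx≮x)  (yes σy<y) = ⊥-elim ∘ image-large y∈ σy<y σx≮x ∘ sym
    cases (no σx≮x)  (no σy≮y)  = λ ρx≡ρy → trans (sym (ρ-small σx≮x)) (trans ρx≡ρy (ρ-small σy≮y))

  ρ-hits : ∀ {x i y} → x ∈ halves → i ∈ halves → i < x → y ∈ halves → x ∸ i ≡ σ y → fold (x ℕ.+ i) ≡ y → ρ x ≡ y
  ρ-hits {x} {i} {y} x∈ i∈ i<x y∈ x∸i≡σy fold≡y =
    trans (ρ-large x∈ σx<x) (trans (cong (λ t → fold (x ℕ.+ t)) (sym i≡σx)) fold≡y)
    where
    open ≈-Reasoning
    x+i<p : x ℕ.+ i < p
    x+i<p = ℕ.s≤s (ℕP.+-mono-≤ (proj₂ (∈-oneTo⁻ x∈)) (proj₂ (∈-oneTo⁻ i∈)))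
    2[x²+i²]≈0 : + 2 * (+ x * + x + + i * + i) ≈ + 2 * 0ℤ
    2[x²+i²]≈0 = begin
      + 2 * (+ x * + x + + i * + i)                      ≡⟨ squares-of-sum-and-difference (ℕP.<⇒≤ i<x) ⟨
      + (x ℕ.+ i) * + (x ℕ.+ i) + + (x ∸ i) * + (x ∸ i)  ≈⟨ +-cong (≈-sym (fold-square x+i<p)) ≈-refl ⟩
      + fold (x ℕ.+ i) * + fold (x ℕ.+ i) + + (x ∸ i) * + (x ∸ i)
                                                           ≡⟨ cong₂ (λ s d → + s * + s + + d * + d) fold≡y x∸i≡σy ⟩
      + y * + y + + σ y * + σ y  ≈⟨ ≈-⇒+≈0 (σ-square y∈) ⟩
      0ℤ                         ≡⟨ ℤP.*-zeroʳ (+ 2) ⟨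
      + 2 * 0ℤ                   ∎
    i≡σx : i ≡ σ x
    i≡σx = σ-unique x∈ i∈ (*-cancelˡ-≈ p-prime (residue-≉0 (ℕ.s≤s ℕ.z≤n) 2<p) 2[x²+i²]≈0)
    σx<x : σ x < x
    σx<x = subst (_< x) i≡σx i<x

  module _ {y} (y∈ : y ∈ halves) (σy<y : σ y < y) where

    private
      0<σy : 0 < σ y
      0<σy = proj₁ (∈-oneTo⁻ (σ-∈ y∈))
      y≤n : y ≤ n
      y≤n = proj₂ (∈-oneTo⁻ y∈)

    preimage-even : ∀ {q} → y ℕ.+ σ y ≡ q ℕ.+ q → Σ ℕ λ x → x ∈ halves × ρ x ≡ y
    preimage-even {q} y+σy≡2q = q , q∈ , ρ-hits q∈ i∈ i<q y∈ q∸i≡σy fold≡y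
      where
      q<y : q < y
      q<y = double-<⇒< (subst (_< y ℕ.+ y) y+σy≡2q (ℕP.+-monoʳ-< y σy<y))
      i : ℕ
      i = y ∸ q
      i+q≡y : i ℕ.+ q ≡ y
      i+q≡y = ℕP.m∸n+n≡m (ℕP.<⇒≤ q<y)
      i+σy≡q : i ℕ.+ σ y ≡ q
      i+σy≡q = ℕP.+-cancelʳ-≡ q (i ℕ.+ σ y) q (begin
        (i ℕ.+ σ y) ℕ.+ q  ≡⟨ rearrange i (σ y) q ⟩
        (i ℕ.+ q) ℕ.+ σ y  ≡⟨ cong (ℕ._+ σ y) i+q≡y ⟩
        y ℕ.+ σ y          ≡⟨ y+σy≡2q ⟩
        q ℕ.+ q            ∎)
        where
        open ≡-Reasoning
        rearrange : ∀ i a q → (i ℕ.+ a) ℕ.+ q ≡ (i ℕ.+ q) ℕ.+ a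
        rearrange = ℕSolver.solve-∀
      0<i : 0 < i
      0<i = ℕP.m<n⇒0<n∸m q<y
      i<q : i < q
      i<q = subst (i <_) i+σy≡q (ℕP.m<m+n i 0<σy)
      q∈ : q ∈ halves
      q∈ = ∈-oneTo⁺ (ℕP.<-trans 0<i i<q) (ℕP.≤-trans (ℕP.<⇒≤ q<y) y≤n)
      i∈ : i ∈ halves
      i∈ = ∈-oneTo⁺ 0<i (ℕP.≤-trans (ℕP.m∸n≤m y q) y≤n)
      q∸i≡σy : q ∸ i ≡ σ y
      q∸i≡σy = trans (cong (_∸ i) (sym i+σy≡q)) (ℕP.m+n∸m≡n i (σ y))
      fold≡y : fold (q ℕ.+ i) ≡ y
      fold≡y = trans (cong fold (trans (ℕP.+-comm q i) i+q≡y)) (fold-small y≤n)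

    preimage-odd : ∀ {q} → y ℕ.+ σ y ≡ suc (q ℕ.+ q) → Σ ℕ λ x → x ∈ halves × ρ x ≡ y
    preimage-odd {q} y+σy≡2q+1 = x , x∈ , ρ-hits x∈ i∈ i<x y∈ (ℕP.m+n∸m≡n i (σ y)) fold≡y
      where
      q<n : q < n
      q<n = double-<⇒< (ℕP.<-≤-trans (ℕP.n<1+n (q ℕ.+ q))
              (ℕP.<⇒≤ (ℕP.<-≤-trans (subst (_< y ℕ.+ y) y+σy≡2q+1 (ℕP.+-monoʳ-< y σy<y)) (ℕP.+-mono-≤ y≤n y≤n))))
      σy≤q : σ y ≤ q
      σy≤q = double-≤⇒≤ (ℕ.≤-pred (subst (σ y ℕ.+ σ y <_) y+σy≡2q+1 (ℕP.+-monoˡ-< (σ y) σy<y)))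
      i x : ℕ
      i = n ∸ q
      x = i ℕ.+ σ y
      i+q≡n : i ℕ.+ q ≡ n
      i+q≡n = ℕP.m∸n+n≡m (ℕP.<⇒≤ q<n)
      0<i : 0 < i
      0<i = ℕP.m<n⇒0<n∸m q<n
      x∈ : x ∈ halves
      x∈ = ∈-oneTo⁺ (ℕP.<-≤-trans 0<i (ℕP.m≤m+n i (σ y))) (subst (x ≤_) i+q≡n (ℕP.+-monoʳ-≤ i σy≤q))
      i∈ : i ∈ halves
      i∈ = ∈-oneTo⁺ 0<i (ℕP.m∸n≤m n q)
      i<x : i < x
      i<x = ℕP.m<m+n i 0<σy
      x+i+y≡p : (x ℕ.+ i) ℕ.+ y ≡ p
      x+i+y≡p = begin
        ((i ℕ.+ σ y) ℕ.+ i) ℕ.+ y      ≡⟨ rearrange i (σ y) y ⟩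
        (i ℕ.+ i) ℕ.+ (y ℕ.+ σ y)      ≡⟨ cong ((i ℕ.+ i) ℕ.+_) y+σy≡2q+1 ⟩
        (i ℕ.+ i) ℕ.+ suc (q ℕ.+ q)    ≡⟨ regroup i q ⟩
        suc ((i ℕ.+ q) ℕ.+ (i ℕ.+ q))  ≡⟨ cong (λ t → suc (t ℕ.+ t)) i+q≡n ⟩
        p                              ∎
        where
        open ≡-Reasoning
        rearrange : ∀ i a y → ((i ℕ.+ a) ℕ.+ i) ℕ.+ y ≡ (i ℕ.+ i) ℕ.+ (y ℕ.+ a)
        rearrange = ℕSolver.solve-∀
        regroup : ∀ i q → (i ℕ.+ i) ℕ.+ suc (q ℕ.+ q) ≡ suc ((i ℕ.+ q) ℕ.+ (i ℕ.+ q))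
        regroup = ℕSolver.solve-∀
      fold≡y : fold (x ℕ.+ i) ≡ y
      fold≡y = fold-complement y∈ x+i+y≡p

  ρ-surjective : ∀ {y} → y ∈ halves → Σ ℕ λ x → x ∈ halves × ρ x ≡ y
  ρ-surjective {y} y∈ with large? y
  ... | no σy≮y  = y , y∈ , ρ-small σy≮y
  ... | yes σy<y with even-or-odd (y ℕ.+ σ y)
  ...   | q , inj₁ even = preimage-even y∈ σy<y {q} even
  ...   | q , inj₂ odd  = preimage-odd y∈ σy<y {q} odd

  ρ-bijection : IsBijectionOn ρ halves halves
  ρ-bijection = record { maps-to = ρ-∈ ; injective = ρ-injective ; surjective = ρ-surjective }

  -- The excluded factors

  smaller : ℕ → ℤ
  smaller y = select (large? y) (+ σ y)

  smaller-ρ : ∀ {x} → x ∈ halves → smaller (ρ x) ≡ select (large? x) (+ (x ∸ σ x))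
  smaller-ρ {x} x∈ = cases (large? x)
    where
    cases : Dec (σ x < x) → smaller (ρ x) ≡ select (large? x) (+ (x ∸ σ x))
    cases (yes σx<x) = begin
      smaller (ρ x)                    ≡⟨ cong smaller (ρ-large x∈ σx<x) ⟩
      smaller (fold (x ℕ.+ σ x))       ≡⟨ select-yes (large? _) _ (fold-sum-large x∈ σx<x) ⟩
      + σ (fold (x ℕ.+ σ x))           ≡⟨ cong +_ (σ-fold-sum x∈ σx<x) ⟩
      + (x ∸ σ x)                      ≡⟨ select-yes (large? x) _ σx<x ⟨
      select (large? x) (+ (x ∸ σ x))  ∎
      where open ≡-Reasoning
    cases (no σx≮x) = trans (cong smaller (ρ-small σx≮x))
                            (trans (select-no (large? x) _ σx≮x) (sym (select-no (large? x) _ σx≮x)))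

  big-smaller : big smaller halves ≡ big (λ x → select (large? x) (+ (x ∸ σ x))) halves
  big-smaller = trans (sym (big-reindex smaller halves-unique halves-unique ρ-bijection)) (big-cong halves smaller-ρ)

  count-large : count large? halves ≡ m
  count-large = double-injective (sym (begin
    m ℕ.+ m                                     ≡⟨ length-oneTo n ⟨
    length halves                               ≡⟨ length-involution halves-unique σ-∈ σ-involutive ⟩
    (c ℕ.+ c) ℕ.+ count (λ x → σ x ≟ x) halves  ≡⟨ cong ((c ℕ.+ c) ℕ.+_) no-fixed-points ⟩
    (c ℕ.+ c) ℕ.+ 0                             ≡⟨ ℕP.+-identityʳ (c ℕ.+ c) ⟩
    c ℕ.+ c                                     ∎))
    where
    open ≡-Reasoning
    c : ℕ
    c = count large? halves
    no-fixed-points : count (λ x → σ x ≟ x) halves ≡ 0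
    no-fixed-points = Sumℕ.big-ε _ halves λ {x} x∈ → Sumℕ.select-no (σ x ≟ x) 1 (σ-no-fixed-point x∈)

  big-pair-products : big (λ x → select (large? x) (+ x * + σ x)) halves ≡ factorial n
  big-pair-products = sym (begin
    factorial n               ≡⟨ big-involution halves-unique σ-∈ σ-involutive (λ i → + i) ⟩
    Pairs * big fixed halves  ≡⟨ cong (Pairs *_) (big-ε fixed halves λ {x} x∈ → select-no (σ x ≟ x) (+ x) (σ-no-fixed-point x∈)) ⟩
    Pairs * 1ℤ                ≡⟨ ℤP.*-identityʳ Pairs ⟩
    Pairs                     ∎)
    where
    open ≡-Reasoning
    Pairs : ℤ
    Pairs = big (λ x → select (large? x) (+ x * + σ x)) halves
    fixed : ℕ → ℤ
    fixed x = select (σ x ≟ x) (+ x)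

  square≈-σ-square : ∀ {x} → x ∈ halves → + (x ℕ.* x) ≈ - (+ σ x * + σ x)
  square≈-σ-square {x} x∈ = begin
    + (x ℕ.* x)            ≡⟨ ℤP.pos-* x x ⟩
    + x * + x              ≡⟨ cong (λ z → + z * + z) (σ-involutive x∈) ⟨
    + σ (σ x) * + σ (σ x)  ≈⟨ σ-square (σ-∈ x∈) ⟩
    - (+ σ x * + σ x)      ∎
    where open ≈-Reasoning

  minusTwos : ℤ
  minusTwos = big (λ x → select (large? x) (- + 2)) halves

  minusTwos-square : minusTwos * minusTwos ≡ (+ 2) ^ n
  minusTwos-square = begin
    minusTwos * minusTwos                             ≡⟨ big-∙ _ _ halves ⟨
    big (λ x → select (large? x) (- + 2) * select (large? x) (- + 2)) halves
                                                      ≡⟨ big-cong halves (λ {x} _ → select-∙ (large? x) (- + 2) (- + 2)) ⟩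
    big (λ x → select (large? x) (+ 4)) halves  ≡⟨ big-select-const large? (+ 4) halves ⟩
    (+ 4) ^ count large? halves                 ≡⟨ cong (λ e → (+ 4) ^ e) count-large ⟩
    (+ 4) ^ m                                   ≡⟨ 4^≡2^double m ⟩
    (+ 2) ^ n                                   ∎
    where
    open ≡-Reasoning
    4^≡2^double : ∀ k → (+ 4) ^ k ≡ (+ 2) ^ (k ℕ.+ k)
    4^≡2^double zero    = refl
    4^≡2^double (suc k) = begin
      + 4 * (+ 4) ^ k              ≡⟨ cong (λ z → + 4 * z) (4^≡2^double k) ⟩
      + 4 * (+ 2) ^ (k ℕ.+ k)      ≡⟨ ℤP.*-assoc (+ 2) (+ 2) _ ⟩
      (+ 2) ^ suc (suc (k ℕ.+ k))  ≡⟨ cong (λ e → (+ 2) ^ suc e) (ℕP.+-suc k k) ⟨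
      (+ 2) ^ (suc k ℕ.+ suc k)    ∎

  pairSquareDifference : ℕ → ℤ
  pairSquareDifference j = select (large? j) (+ (j ℕ.* j) - + (σ j ℕ.* σ j))

  big-pairSquareDifference-smaller : big pairSquareDifference halves ≈ minusTwos * (big smaller halves * big smaller halves)
  big-pairSquareDifference-smaller = begin
    big pairSquareDifference halves
      ≈⟨ big-≈ halves (λ {x} x∈ → per-element x∈ (large? x)) ⟩
    big (λ x → select (large? x) (- + 2) * (smaller x * smaller x)) halves
      ≡⟨ big-∙ _ _ halves ⟩
    minusTwos * big (λ x → smaller x * smaller x) halves
      ≡⟨ cong (minusTwos *_) (big-∙ smaller smaller halves) ⟩
    minusTwos * (big smaller halves * big smaller halves) ∎
    where
    open ≈-Reasoning
    per-element : ∀ {x} → x ∈ halves → (d : Dec (σ x < x)) →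
                  select d (+ (x ℕ.* x) - + (σ x ℕ.* σ x)) ≈ select d (- + 2) * (select d (+ σ x) * select d (+ σ x))
    per-element {x} x∈ (yes _) = begin
      + (x ℕ.* x) - + (σ x ℕ.* σ x)      ≈⟨ +-cong (square≈-σ-square x∈) (≡⇒≈ (cong -_ (ℤP.pos-* (σ x) (σ x)))) ⟩
      - (+ σ x * + σ x) - + σ x * + σ x  ≡⟨ lemma (+ σ x) ⟩
      - + 2 * (+ σ x * + σ x)            ∎
      where lemma : ∀ s → - (s * s) - s * s ≡ - + 2 * (s * s)
            lemma = solve-∀
    per-element x∈ (no _) = ≈-refl

  big-differences² : big (λ x → select (large? x) (+ (x ∸ σ x))) halves
                       * big (λ x → select (large? x) (+ (x ∸ σ x))) halves ≈ minusTwos * factorial n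
  big-differences² = begin
    big difference halves * big difference halves
      ≡⟨ big-∙ difference difference halves ⟨
    big (λ x → difference x * difference x) halves
      ≈⟨ big-≈ halves (λ {x} x∈ → per-element x∈ (large? x)) ⟩
    big (λ x → select (large? x) (- + 2) * select (large? x) (+ x * + σ x)) halves
      ≡⟨ big-∙ _ _ halves ⟩
    minusTwos * big (λ x → select (large? x) (+ x * + σ x)) halves
      ≡⟨ cong (minusTwos *_) big-pair-products ⟩
    minusTwos * factorial n ∎
    where
    open ≈-Reasoning
    difference : ℕ → ℤ
    difference x = select (large? x) (+ (x ∸ σ x))
    per-element : ∀ {x} → x ∈ halves → (d : Dec (σ x < x)) →
                  select d (+ (x ∸ σ x)) * select d (+ (x ∸ σ x)) ≈ select d (- + 2) * select d (+ x * + σ x)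
    per-element {x} x∈ (yes σx<x) = begin
      + (x ∸ σ x) * + (x ∸ σ x)                            ≡⟨ cong (λ d → d * d) (pos-∸ (ℕP.<⇒≤ σx<x)) ⟩
      (+ x - + σ x) * (+ x - + σ x)                        ≡⟨ lemma (+ x) (+ σ x) ⟩
      (+ x * + x + + σ x * + σ x) + - + 2 * (+ x * + σ x)  ≈⟨ +-cong (≈-⇒+≈0 (σ-square x∈)) ≈-refl ⟩
      0ℤ + - + 2 * (+ x * + σ x)                           ≡⟨ ℤP.+-identityˡ _ ⟩
      - + 2 * (+ x * + σ x)                                ∎
      where lemma : ∀ x s → (x - s) * (x - s) ≡ (x * x + s * s) + - + 2 * (x * s)
            lemma = solve-∀
    per-element x∈ (no _) = ≈-refl

  big-pairSquareDifference≈2ⁿn! : big pairSquareDifference halves ≈ (+ 2) ^ n * factorial n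
  big-pairSquareDifference≈2ⁿn! = begin
    big pairSquareDifference halves                        ≈⟨ big-pairSquareDifference-smaller ⟩
    minusTwos * (big smaller halves * big smaller halves)  ≡⟨ cong (λ s → minusTwos * (s * s)) big-smaller ⟩
    minusTwos * (D * D)                                    ≈⟨ *-congˡ minusTwos big-differences² ⟩
    minusTwos * (minusTwos * factorial n)                  ≡⟨ ℤP.*-assoc minusTwos minusTwos (factorial n) ⟨
    (minusTwos * minusTwos) * factorial n                  ≡⟨ cong (_* factorial n) minusTwos-square ⟩
    (+ 2) ^ n * factorial n                                ∎
    where
    open ≈-Reasoning
    D : ℤ
    D = big (λ x → select (large? x) (+ (x ∸ σ x))) halves

  included excluded : ℕ → ℤ
  included j = big (λ i → select (¬? (p ℕD.∣? (i ℕ.* i ℕ.+ j ℕ.* j))) (+ (j ℕ.* j) - + (i ℕ.* i))) (oneTo (ℕ.pred j))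
  excluded j = big (λ i → select (p ℕD.∣? (i ℕ.* i ℕ.+ j ℕ.* j)) (+ (j ℕ.* j) - + (i ℕ.* i))) (oneTo (ℕ.pred j))

  included*excluded : ∀ j → included j * excluded j ≡ squareDifferences j
  included*excluded j = trans (sym (big-∙ _ _ (oneTo (ℕ.pred j))))
    (big-cong (oneTo (ℕ.pred j)) λ {i} _ → select-¬?-∙ (p ℕD.∣? (i ℕ.* i ℕ.+ j ℕ.* j)) (+ (j ℕ.* j) - + (i ℕ.* i)))

  sum-of-squares : ∀ i j → + (i ℕ.* i ℕ.+ j ℕ.* j) ≡ + j * + j + + i * + i
  sum-of-squares i j = trans (ℤP.pos-+ (i ℕ.* i) (j ℕ.* j))
    (trans (cong₂ _+_ (ℤP.pos-* i i) (ℤP.pos-* j j)) (ℤP.+-comm (+ i * + i) (+ j * + j)))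

  divides⇒σ : ∀ {i j} → i ∈ halves → j ∈ halves → p ℕD.∣ i ℕ.* i ℕ.+ j ℕ.* j → i ≡ σ j
  divides⇒σ {i} {j} i∈ j∈ p∣ = σ-unique j∈ i∈ (≈-trans (≡⇒≈ (sym (sum-of-squares i j))) (∣⇒≈0 (∣ᵤ⇒∣ p∣)))

  σ-divides : ∀ {j} → j ∈ halves → p ℕD.∣ σ j ℕ.* σ j ℕ.+ j ℕ.* j
  σ-divides {j} j∈ = ∣⇒∣ᵤ (≈0⇒∣ (≈-trans (≡⇒≈ (sum-of-squares (σ j) j)) (≈-⇒+≈0 (σ-square j∈))))

  ∈-below : ∀ {i j} → j ∈ halves → i ∈ oneTo (ℕ.pred j) → i ∈ halves × i < j
  ∈-below {i} {suc j} j∈ i∈ =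
    ∈-oneTo⁺ (proj₁ (∈-oneTo⁻ i∈)) (ℕP.≤-trans (ℕP.m≤n⇒m≤1+n (proj₂ (∈-oneTo⁻ i∈))) (proj₂ (∈-oneTo⁻ j∈))) ,
    ℕ.s≤s (proj₂ (∈-oneTo⁻ i∈))

  excluded≡ : ∀ {j} → j ∈ halves → excluded j ≡ pairSquareDifference j
  excluded≡ {j} j∈ = cases (large? j)
    where
    factor : ℕ → ℤ
    factor i = select (p ℕD.∣? (i ℕ.* i ℕ.+ j ℕ.* j)) (+ (j ℕ.* j) - + (i ℕ.* i))
    factor≡1 : ∀ {i} → i ∈ oneTo (ℕ.pred j) → i ≢ σ j → factor i ≡ 1ℤ
    factor≡1 {i} i∈ i≢σj = select-no (p ℕD.∣? (i ℕ.* i ℕ.+ j ℕ.* j)) _ (i≢σj ∘ divides⇒σ (proj₁ (∈-below j∈ i∈)) j∈)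
    cases : Dec (σ j < j) → excluded j ≡ pairSquareDifference j
    cases (yes σj<j) = begin
      excluded j                     ≡⟨ big-one-point factor (oneTo-unique (ℕ.pred j)) σj∈ factor≡1 ⟩
      factor (σ j)                   ≡⟨ select-yes (p ℕD.∣? _) _ (σ-divides j∈) ⟩
      + (j ℕ.* j) - + (σ j ℕ.* σ j)  ≡⟨ select-yes (large? j) _ σj<j ⟨
      pairSquareDifference j         ∎
      where
      open ≡-Reasoning
      σj∈ : σ j ∈ oneTo (ℕ.pred j)
      σj∈ = ∈-oneTo⁺ (proj₁ (∈-oneTo⁻ (σ-∈ j∈))) (ℕP.<⇒≤pred σj<j)
    cases (no σj≮j) =
      trans (big-ε factor (oneTo (ℕ.pred j)) λ i∈ → factor≡1 i∈ λ { refl → σj≮j (proj₂ (∈-below j∈ i∈)) })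
            (sym (select-no (large? j) _ σj≮j))

  included-product : big included halves * ((+ 2) ^ n * (factorial n * factorial n)) ≈ 1ℤ
  included-product = begin
    G * ((+ 2) ^ n * (factorial n * factorial n))             ≡⟨ cong (G *_) (ℤP.*-assoc ((+ 2) ^ n) (factorial n) (factorial n)) ⟨
    G * (((+ 2) ^ n * factorial n) * factorial n)             ≈⟨ *-congˡ G (*-congʳ (factorial n) big-pairSquareDifference≈2ⁿn!) ⟨
    G * (big pairSquareDifference halves * factorial n)       ≡⟨ cong (λ b → G * (b * factorial n)) (big-cong halves excluded≡) ⟨
    G * (big excluded halves * factorial n)                   ≡⟨ ℤP.*-assoc G (big excluded halves) (factorial n) ⟨
    (G * big excluded halves) * factorial n                   ≡⟨ cong (_* factorial n) (big-∙ included excluded halves) ⟨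
    big (λ j → included j * excluded j) halves * factorial n  ≡⟨ cong (_* factorial n) (big-cong halves λ {j} _ → included*excluded j) ⟩
    big squareDifferences halves * factorial n                ≈⟨ squareDifferences-product ⟩
    1ℤ                                                        ∎
    where
    open ≈-Reasoning
    G : ℤ
    G = big included halves

  big-included≈ : big included halves ≈ - legendre p 2
  big-included≈ = begin
    G                         ≡⟨ ℤP.*-identityʳ G ⟨
    G * 1ℤ                    ≡⟨ cong (G *_) (legendre²≡1 p 2 p∤2) ⟨
    G * (ℓ * ℓ)               ≡⟨ lemma G ℓ ⟩
    - ((G * (ℓ * - 1ℤ)) * ℓ)  ≈⟨ -‿cong (*-congʳ ℓ G[ℓ*-1]≈1) ⟩
    - (1ℤ * ℓ)                ≡⟨ cong -_ (ℤP.*-identityˡ ℓ) ⟩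
    - ℓ                       ∎
    where
    open ≈-Reasoning
    G ℓ : ℤ
    G = big included halves
    ℓ = legendre p 2
    p∤2 : ¬ p ℕD.∣ 2
    p∤2 p∣2 = ℕP.<⇒≱ 2<p (ℕD.∣⇒≤ p∣2)
    lemma : ∀ G ℓ → G * (ℓ * ℓ) ≡ - ((G * (ℓ * - 1ℤ)) * ℓ)
    lemma = solve-∀
    G[ℓ*-1]≈1 : G * (ℓ * - 1ℤ) ≈ 1ℤ
    G[ℓ*-1]≈1 = ≈-trans (*-congˡ G (*-cong (≈-sym (euler-criterion 2 p∤2)) (≈-sym half-factorial-square))) included-product

  cor27Product≈ : cor27Product p ≈ - legendre p 2
  cor27Product≈ = ≈-trans (≡⇒≈ (trans (cor27Product≡big p) (cong (λ K → big included (oneTo K)) half-of-p-1))) big-included≈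
    where
    half-of-p-1 : (p ∸ 1) / 2 ≡ n
    half-of-p-1 = trans (cong (_/ 2) (double≡*2 n)) (m*n/n≡m n 2)
      where double≡*2 : ∀ k → k ℕ.+ k ≡ k ℕ.* 2
            double≡*2 = ℕSolver.solve-∀

p%4≡1⇒p≡4m+1 : ∀ p → p % 4 ≡ 1 → p ≡ suc ((p / 4 ℕ.+ p / 4) ℕ.+ (p / 4 ℕ.+ p / 4))
p%4≡1⇒p≡4m+1 p p%4≡1 = trans (m≡m%n+[m/n]*n p 4) (cong₂ ℕ._+_ p%4≡1 (lemma (p / 4)))
  where lemma : ∀ m → m ℕ.* 4 ≡ (m ℕ.+ m) ℕ.+ (m ℕ.+ m)
        lemma = ℕSolver.solve-∀

corollary2p7 : (p : ℕ) → Prime p → p % 4 ≡ 1 → cor27Product p ≡ - legendre p 2 [mod p ]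
corollary2p7 p p-prime p%4≡1 =
  subst (λ q → cor27Product q ≡ - legendre q 2 [mod q ]) (sym p≡4m+1) (≈⇒≡[mod] cor27Product≈)
  where
  p≡4m+1 = p%4≡1⇒p≡4m+1 p p%4≡1
  open PythagoreanPrime (p / 4) (subst Prime p≡4m+1 p-prime)
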